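{- Let $R_n$ be the $n\times n$ integer matrix whose $(i,j)$ entry is $\binom{i-1}{n-j}$, and let $p_n(x)\in\mathbb{F}_5[x]$ be the reduction modulo $5$ of its characteristic polynomial $\det(R_n-xI_n)$. Then for all integers $k\ge 0$ (with $n\ge 1$), in $\mathbb{F}_5[x]$: \[ p_{4k}(x)=(x-2)^{4k},\quad p_{4k+1}(x)=-(x-1)^{4k+1},\quad p_{4k+2}(x)=(x+2)^{4k+2},\quad p_{4k+3}(x)=-(x+1)^{4k+3}. \]
   Context: Binomial coefficients $\binom{a}{b}$ are $0$ when $b<0$ or $b>a$. The characteristic polynomial is normalized as $\det(R_n-xI_n)$, so its leading coefficient is $(-1)^n$. -}

module Defs where

open import Data.Nat as ℕ using (ℕ; zero; suc)
open import Data.Nat.Combinatorics using (_C_)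
open import Data.Integer as ℤ using (ℤ; +_; -_)
open import Data.Integer.Divisibility using (_∣_)
open import Data.Fin using (Fin; zero; suc; toℕ; punchIn; _≟_)
open import Data.List using (List; []; _∷_; map)
open import Relation.Nullary using (yes; no)

-- Polynomials with integer coefficients, as coefficient lists
-- (constant term first); trailing zeros are allowed.
Poly : Set
Poly = List ℤ

_+P_ : Poly → Poly → Poly
[] +P q = q
(a ∷ p) +P [] = a ∷ p
(a ∷ p) +P (b ∷ q) = (a ℤ.+ b) ∷ (p +P q)

-P_ : Poly → Poly
-P p = map -_ p

_*P_ : Poly → Poly → Poly
[] *P q = []
(a ∷ p) *P q = map (a ℤ.*_) q +P (+ 0 ∷ (p *P q))

_^P_ : Poly → ℕ → Poly
p ^P zero = + 1 ∷ []
p ^P suc n = p *P (p ^P n)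

constP : ℤ → Poly
constP a = a ∷ []

X : Poly
X = + 0 ∷ + 1 ∷ []

coeff : Poly → ℕ → ℤ
coeff [] k = + 0
coeff (a ∷ p) zero = a
coeff (a ∷ p) (suc k) = coeff p k

-- Equality of the reductions modulo 5, i.e. equality in 𝔽₅[x].
_≡[mod5]_ : Poly → Poly → Set
p ≡[mod5] q = ∀ k → + 5 ∣ (coeff p k ℤ.- coeff q k)

sumP : ∀ m → (Fin m → Poly) → Poly
sumP zero f = []
sumP (suc m) f = f zero +P sumP m (λ i → f (suc i))

signP : ℕ → Poly → Poly
signP zero p = p
signP (suc j) p = -P (signP j p)

det : ∀ n → (Fin n → Fin n → Poly) → Poly
det zero M = constP (+ 1)
det (suc n) M =
  sumP (suc n) (λ j → signP (toℕ j)
    (M zero j *P det n (λ i k → M (suc i) (punchIn j k))))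

-- R_n with (i,j) entry binom(i-1, n-j) (1-indexed); with 0-indexed
-- i', j' this is binom(i', n-1-j').
R : ∀ n → Fin n → Fin n → ℤ
R n i j = + (toℕ i C (n ℕ.∸ suc (toℕ j)))

charMatrix : ∀ n → Fin n → Fin n → Poly
charMatrix n i j with i ≟ j
... | yes _ = constP (R n i j) +P (-P X)
... | no _ = constP (R n i j)

charPoly : ℕ → Poly
charPoly n = det n (charMatrix n)

{-# OPTIONS --safe #-}
-- Let P be the lower unitriangular matrix whose rows are the coefficients of (x + 2)ⁱ, i ≤ N.
-- Reading a row vector v as the polynomial ∑ⱼ vⱼ xʲ, the k-th row of R = R_(N+1) is x^(N−k) (x + 1)ᵏ,
-- so by the binomial theorem the i-th row of P R is x^(N−i) (1 + 3x)ⁱ.  Modulo 5 this equals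
-- (3(x + 2))ⁱ ((x + 2) + 3)^(N−i), which expands in the powers (x + 2)ᵏ with an upper triangular
-- coefficient matrix T of constant diagonal 3ᴺ.  Hence P R ≡ T P, and as P is unitriangular,
-- det(R − xI) ≡ det(T − xI) = (3ᴺ − x)^(N+1).  The four cases then follow from 3⁴ ≡ 1 (mod 5).
module Submission where

open import Algebra.Bundles using (CommutativeMonoid; CommutativeRing)
open import Algebra.Structures using (IsCommutativeMonoid)
open import Data.Empty using (⊥-elim)
open import Data.Fin as Fin using (Fin; zero; suc; toℕ; punchIn; _≟_)
open import Data.Fin.Properties using (<⇒≢; toℕ<n)
open import Data.Integer as ℤ using (ℤ; +_) renaming (_+_ to _+ℤ_; _*_ to _*ℤ_; _-_ to _-ℤ_)
import Data.Integer.Properties as ℤ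
open import Data.Integer.Divisibility.Signed
  using (_∣_; divides; ∣m∣n⇒∣m+n; ∣m⇒∣-m; ∣n⇒∣m*n; ∣⇒∣ᵤ)
open import Data.Integer.Tactic.RingSolver using (solve-∀)
open import Data.List using ([]; _∷_; map)
open import Data.Maybe using (nothing)
open import Data.Nat as ℕ using (ℕ; zero; suc; _∸_; z≤n; s≤s)
import Data.Nat.Properties as ℕ
open import Data.Nat.Combinatorics
  using (_C_; nCn≡1; k>n⇒nCk≡0; nCk≡nC[n∸k]; nCk+nC[k+1]≡[n+1]C[k+1])
open import Data.Nat.Tactic.RingSolver using () renaming (solve-∀ to solve-∀ℕ)
open import Data.Product using (_,_)
open import Data.Vec.Functional as Vector using (Vector; removeAt; replicate; updateAt; transpose; tail)
open import Data.Vec.Functional.Properties using (map-updateAt-local; updateAt-updates)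
open import Function using (_∘_; const)
open import Level using (0ℓ)
open import Relation.Binary.Bundles using (Setoid)
open import Relation.Binary.PropositionalEquality as ≡ using (_≡_; _≢_)
import Relation.Binary.Reasoning.Setoid as SetoidReasoning
open import Relation.Binary.Structures using (IsEquivalence)
open import Relation.Nullary using (yes; no)
import Tactic.RingSolver.Core.AlmostCommutativeRing as ACR
import Tactic.RingSolver.NonReflective as NonReflective

open import Defs hiding (det; R)

module Summation {c ℓ} (R : CommutativeRing c ℓ) where

  open CommutativeRing R hiding (zero)
  open import Algebra.Properties.Ring ring using (-0#≈0#; -‿+-comm)
  open import Algebra.Properties.Semiring.Sum semiring
    using (sum-syntax; sum⁺-syntax; sum-cong-≋; ∑-distrib-+; *-distribˡ-sum; sum-replicate-zero)

  ∑-zero : ∀ {n} {f : Vector Carrier n} → (∀ i → f i ≈ 0#) → ∑[ i < n ] f i ≈ 0#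
  ∑-zero {n} e = trans (sum-cong-≋ e) (sum-replicate-zero n)

  ∑-neg : ∀ {n} (f : Vector Carrier n) → ∑[ i < n ] (- f i) ≈ - ∑[ i < n ] f i
  ∑-neg {zero}  f = sym -0#≈0#
  ∑-neg {suc n} f = trans (+-congˡ (∑-neg (f ∘ suc))) (-‿+-comm (f zero) (∑[ i < n ] f (suc i)))

  ∑-sub-*ˡ : ∀ {n} x (f g : Vector Carrier n) →
    ∑[ i < n ] (f i - x * g i) ≈ ∑[ i < n ] f i - x * ∑[ i < n ] g i
  ∑-sub-*ˡ x f g = trans (∑-distrib-+ f (λ i → - (x * g i)))
    (+-congˡ (trans (∑-neg (λ i → x * g i)) (-‿cong (sym (*-distribˡ-sum x g)))))

  ∑-truncate : ∀ {N i} → i ℕ.≤ N → (f : ℕ → Carrier) → (∀ k → i ℕ.< k → f k ≈ 0#) →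
    ∑[ k ≤ N ] f (toℕ k) ≈ ∑[ k ≤ i ] f (toℕ k)
  ∑-truncate {N}     {zero}  z≤n       f vanish =
    +-congˡ (∑-zero {N} λ k → vanish (suc (toℕ k)) (s≤s z≤n))
  ∑-truncate {suc N} {suc i} (s≤s i≤N) f vanish =
    +-congˡ (∑-truncate i≤N (f ∘ suc) (λ k i<k → vanish (suc k) (s≤s i<k)))

module Determinant {c ℓ} (R : CommutativeRing c ℓ) where

  open CommutativeRing R hiding (zero)
  open Summation R
  open import Algebra.Properties.Monoid.Sum *-monoid
    using () renaming (sum to product; sum-cong-≋ to product-cong; sum-replicate to product-replicate)
  open import Algebra.Properties.Ring ring
    using (-0#≈0#; -‿+-comm; -‿involutive; -‿distribˡ-*; -‿distribʳ-*)
  open import Algebra.Properties.Semiring.Exp semiring using (_^_)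
  open import Algebra.Properties.Semiring.Sum semiring
    using (sum-syntax; sum-cong-≋; ∑-distrib-+; ∑-comm; *-distribˡ-sum)
  open import Algebra.Properties.CommutativeSemigroup *-commutativeSemigroup using (x∙yz≈y∙xz)
  open import Algebra.Properties.CommutativeSemigroup +-commutativeSemigroup
    using () renaming (x∙yz≈y∙xz to +-x∙yz≈y∙xz; xy∙z≈x∙zy to +-xy∙z≈x∙zy)
  open SetoidReasoning setoid

  signed : ℕ → Carrier → Carrier
  signed zero    x = x
  signed (suc k) x = - signed k x

  signed-neg : ∀ k x → signed k (- x) ≡ - signed k x
  signed-neg zero    x = ≡.refl
  signed-neg (suc k) x = ≡.cong -_ (signed-neg k x)

  signed-comm : ∀ k l x → signed k (signed l x) ≡ signed l (signed k x)
  signed-comm zero    l x = ≡.refl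
  signed-comm (suc k) l x = ≡.trans (≡.cong -_ (signed-comm k l x)) (≡.sym (signed-neg l (signed k x)))

  signed-cong : ∀ k {x y} → x ≈ y → signed k x ≈ signed k y
  signed-cong zero    e = e
  signed-cong (suc k) e = -‿cong (signed-cong k e)

  signed-zero : ∀ k → signed k 0# ≈ 0#
  signed-zero zero    = refl
  signed-zero (suc k) = trans (-‿cong (signed-zero k)) -0#≈0#

  signed-+ : ∀ k x y → signed k (x + y) ≈ signed k x + signed k y
  signed-+ zero    x y = refl
  signed-+ (suc k) x y = trans (-‿cong (signed-+ k x y)) (sym (-‿+-comm (signed k x) (signed k y)))

  signed-*ˡ : ∀ k a x → signed k (a * x) ≈ a * signed k x
  signed-*ˡ zero    a x = refl
  signed-*ˡ (suc k) a x = trans (-‿cong (signed-*ˡ k a x)) (-‿distribʳ-* a (signed k x))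

  signed-*-negʳ : ∀ k x y → signed k (x * - y) ≈ - signed k (x * y)
  signed-*-negʳ k x y = trans (signed-cong k (sym (-‿distribʳ-* x y))) (reflexive (signed-neg k (x * y)))

  signed-2*+ : ∀ k r x → signed (2 ℕ.* k ℕ.+ r) x ≈ signed r x
  signed-2*+ zero    r x = refl
  signed-2*+ (suc k) r x = begin
    signed (2 ℕ.* suc k ℕ.+ r) x      ≡⟨ ≡.cong (λ n → signed n x) (2*[1+k]+r≡2+[2*k+r] k r) ⟩
    - - signed (2 ℕ.* k ℕ.+ r) x      ≈⟨ -‿involutive _ ⟩
    signed (2 ℕ.* k ℕ.+ r) x          ≈⟨ signed-2*+ k r x ⟩
    signed r x                         ∎
    where
    2*[1+k]+r≡2+[2*k+r] : ∀ k r → 2 ℕ.* suc k ℕ.+ r ≡ 2 ℕ.+ (2 ℕ.* k ℕ.+ r)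
    2*[1+k]+r≡2+[2*k+r] = solve-∀ℕ

  neg-^ : ∀ n y → (- y) ^ n ≈ signed n (y ^ n)
  neg-^ zero    y = refl
  neg-^ (suc n) y = begin
    - y * (- y) ^ n          ≈⟨ *-congˡ (neg-^ n y) ⟩
    - y * signed n (y ^ n)   ≈⟨ -‿distribˡ-* y (signed n (y ^ n)) ⟨
    - (y * signed n (y ^ n)) ≈⟨ -‿cong (signed-*ˡ n y (y ^ n)) ⟨
    - signed n (y * y ^ n)   ∎

  signed-∑ : ∀ k {n} (f : Vector Carrier n) → signed k (∑[ i < n ] f i) ≈ ∑[ i < n ] signed k (f i)
  signed-∑ zero    f = refl
  signed-∑ (suc k) f = trans (-‿cong (signed-∑ k f)) (sym (∑-neg (signed k ∘ f)))

  signed-*-∑ : ∀ k x {n} (f : Vector Carrier n) →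
    signed k (x * ∑[ i < n ] f i) ≈ ∑[ i < n ] signed k (x * f i)
  signed-*-∑ k x f = trans (signed-cong k (*-distribˡ-sum x f)) (signed-∑ k (λ i → x * f i))

  laplace : ∀ {n} → Vector Carrier n → Vector Carrier n → Carrier
  laplace {n} x y = ∑[ j < n ] signed (toℕ j) (x j * y j)

  laplace-cong : ∀ {n} {x x′ y y′ : Vector Carrier n} →
    (∀ j → x j ≈ x′ j) → (∀ j → y j ≈ y′ j) → laplace x y ≈ laplace x′ y′
  laplace-cong e f = sum-cong-≋ λ j → signed-cong (toℕ j) (*-cong (e j) (f j))

  laplace-congʳ : ∀ {n} (x : Vector Carrier n) {y y′ : Vector Carrier n} →
    (∀ j → y j ≈ y′ j) → laplace x y ≈ laplace x y′
  laplace-congʳ x = laplace-cong (λ _ → refl)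

  laplace-comm : ∀ {n} (x y : Vector Carrier n) → laplace x y ≈ laplace y x
  laplace-comm x y = sum-cong-≋ λ j → signed-cong (toℕ j) (*-comm (x j) (y j))

  laplace-+ˡ : ∀ {n} (x x′ y : Vector Carrier n) →
    laplace (λ j → x j + x′ j) y ≈ laplace x y + laplace x′ y
  laplace-+ˡ x x′ y = trans
    (sum-cong-≋ λ j →
      trans (signed-cong (toℕ j) (distribʳ (y j) (x j) (x′ j))) (signed-+ (toℕ j) _ _))
    (∑-distrib-+ (λ j → signed (toℕ j) (x j * y j)) (λ j → signed (toℕ j) (x′ j * y j)))

  laplace-+ʳ : ∀ {n} (x y y′ : Vector Carrier n) →
    laplace x (λ j → y j + y′ j) ≈ laplace x y + laplace x y′
  laplace-+ʳ x y y′ = trans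
    (sum-cong-≋ λ j →
      trans (signed-cong (toℕ j) (distribˡ (x j) (y j) (y′ j))) (signed-+ (toℕ j) _ _))
    (∑-distrib-+ (λ j → signed (toℕ j) (x j * y j)) (λ j → signed (toℕ j) (x j * y′ j)))

  laplace-*ˡ : ∀ {n} a (x y : Vector Carrier n) → laplace (λ j → a * x j) y ≈ a * laplace x y
  laplace-*ˡ a x y = trans
    (sum-cong-≋ λ j → trans (signed-cong (toℕ j) (*-assoc a (x j) (y j))) (signed-*ˡ (toℕ j) a _))
    (sym (*-distribˡ-sum a (λ j → signed (toℕ j) (x j * y j))))

  laplace-negʳ : ∀ {n} (x y : Vector Carrier n) → laplace x (λ j → - y j) ≈ - laplace x y
  laplace-negʳ x y = trans
    (sum-cong-≋ λ j → signed-*-negʳ (toℕ j) (x j) (y j))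
    (∑-neg (λ j → signed (toℕ j) (x j * y j)))

  laplace-zeroʳ : ∀ {n} (x y : Vector Carrier n) → (∀ j → y j ≈ 0#) → laplace x y ≈ 0#
  laplace-zeroʳ x y e = ∑-zero λ j →
    trans (signed-cong (toℕ j) (trans (*-congˡ (e j)) (zeroʳ (x j)))) (signed-zero (toℕ j))

  laplace-∑ʳ : ∀ {m n} (x : Vector Carrier n) (a : Vector Carrier m) (F : Fin m → Vector Carrier n) →
    laplace x (λ j → ∑[ r < m ] (a r * F r j)) ≈ ∑[ r < m ] (a r * laplace x (F r))
  laplace-∑ʳ {m} {n} x a F = begin
    ∑[ j < n ] signed (toℕ j) (x j * ∑[ r < m ] (a r * F r j))
      ≈⟨ sum-cong-≋ (λ j → trans (signed-*-∑ (toℕ j) (x j) (λ r → a r * F r j))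
                                 (sum-cong-≋ λ r → pull (toℕ j) (x j) (a r) (F r j))) ⟩
    ∑[ j < n ] ∑[ r < m ] (a r * signed (toℕ j) (x j * F r j))
      ≈⟨ ∑-comm (λ j r → a r * signed (toℕ j) (x j * F r j)) ⟩
    ∑[ r < m ] ∑[ j < n ] (a r * signed (toℕ j) (x j * F r j))
      ≈⟨ sum-cong-≋ (λ r → *-distribˡ-sum (a r) (λ j → signed (toℕ j) (x j * F r j))) ⟨
    ∑[ r < m ] (a r * laplace x (F r)) ∎
    where
    pull : ∀ k x a y → signed k (x * (a * y)) ≈ a * signed k (x * y)
    pull k x a y = trans (signed-cong k (x∙yz≈y∙xz x a y)) (signed-*ˡ k a (x * y))

  laplace-∑ˡ : ∀ {m n} (a : Vector Carrier m) (F : Fin m → Vector Carrier n) (y : Vector Carrier n) →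
    laplace (λ j → ∑[ r < m ] (a r * F r j)) y ≈ ∑[ r < m ] (a r * laplace (F r) y)
  laplace-∑ˡ a F y = trans (laplace-comm _ y)
    (trans (laplace-∑ʳ y a F) (sum-cong-≋ λ r → *-congˡ (laplace-comm y (F r))))

  laplace-interchange : ∀ {m n} (x : Vector Carrier n) (y : Vector Carrier m) (D : Fin m → Vector Carrier n) →
    laplace x (λ j → laplace y (λ i → D i j)) ≈ laplace y (λ i → laplace x (D i))
  laplace-interchange {m} {n} x y D = begin
    ∑[ j < n ] signed (toℕ j) (x j * ∑[ i < m ] signed (toℕ i) (y i * D i j))
      ≈⟨ sum-cong-≋ (λ j → signed-*-∑ (toℕ j) (x j) (λ i → signed (toℕ i) (y i * D i j))) ⟩
    ∑[ j < n ] ∑[ i < m ] signed (toℕ j) (x j * signed (toℕ i) (y i * D i j))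
      ≈⟨ sum-cong-≋ (λ j → sum-cong-≋ λ i → exchange (toℕ j) (toℕ i) (x j) (y i) (D i j)) ⟩
    ∑[ j < n ] ∑[ i < m ] signed (toℕ i) (y i * signed (toℕ j) (x j * D i j))
      ≈⟨ ∑-comm (λ j i → signed (toℕ i) (y i * signed (toℕ j) (x j * D i j))) ⟩
    ∑[ i < m ] ∑[ j < n ] signed (toℕ i) (y i * signed (toℕ j) (x j * D i j))
      ≈⟨ sum-cong-≋ (λ i → signed-*-∑ (toℕ i) (y i) (λ j → signed (toℕ j) (x j * D i j))) ⟨
    ∑[ i < m ] signed (toℕ i) (y i * ∑[ j < n ] signed (toℕ j) (x j * D i j)) ∎
    where
    pull : ∀ k l x y d → signed k (x * signed l (y * d)) ≈ x * (y * signed k (signed l d))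
    pull k l x y d = begin
      signed k (x * signed l (y * d))  ≈⟨ signed-*ˡ k x (signed l (y * d)) ⟩
      x * signed k (signed l (y * d))  ≈⟨ *-congˡ (signed-cong k (signed-*ˡ l y d)) ⟩
      x * signed k (y * signed l d)    ≈⟨ *-congˡ (signed-*ˡ k y (signed l d)) ⟩
      x * (y * signed k (signed l d))  ∎
    exchange : ∀ k l x y d → signed k (x * signed l (y * d)) ≈ signed l (y * signed k (x * d))
    exchange k l x y d = begin
      signed k (x * signed l (y * d))  ≈⟨ pull k l x y d ⟩
      x * (y * signed k (signed l d))  ≈⟨ x∙yz≈y∙xz x y _ ⟩
      y * (x * signed k (signed l d))  ≡⟨ ≡.cong (λ z → y * (x * z)) (signed-comm k l d) ⟩
      y * (x * signed l (signed k d))  ≈⟨ pull l k y x d ⟨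
      signed l (y * signed k (x * d))  ∎

  Matrix : ℕ → Set c
  Matrix n = Fin n → Fin n → Carrier

  infix 4 _≈ᴹ_
  _≈ᴹ_ : ∀ {n} → Matrix n → Matrix n → Set ℓ
  A ≈ᴹ B = ∀ i j → A i j ≈ B i j

  minor : ∀ {n} → Matrix (suc n) → Fin (suc n) → Matrix n
  minor M j i = removeAt (M (suc i)) j

  columnMinor : ∀ {n} → Matrix (suc n) → Fin (suc n) → Matrix n
  columnMinor M i = transpose (minor (transpose M) i)

  det : ∀ n → Matrix n → Carrier
  det zero    M = 1#
  det (suc n) M = laplace (M zero) (λ j → det n (minor M j))

  det-cong : ∀ n {A B : Matrix n} → A ≈ᴹ B → det n A ≈ det n B
  det-cong zero    e = refl
  det-cong (suc n) e = laplace-cong (e zero) (λ j → det-cong n (λ i k → e (suc i) (punchIn j k)))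

  det-columnExpansion : ∀ n (M : Matrix (suc n)) →
    det (suc n) M ≈ laplace (λ i → M i zero) (λ i → det n (columnMinor M i))
  det-columnExpansion zero    M = refl
  det-columnExpansion (suc n) M = +-congˡ (begin
    ∑[ j < suc n ] (- signed (toℕ j) (M zero (suc j) * det (suc n) (minor M (suc j))))
      ≈⟨ ∑-neg (λ j → signed (toℕ j) (M zero (suc j) * det (suc n) (minor M (suc j)))) ⟩
    - laplace x (λ j → det (suc n) (minor M (suc j)))
      ≈⟨ -‿cong (laplace-congʳ x (λ j → det-columnExpansion n (minor M (suc j)))) ⟩
    - laplace x (λ j → laplace y (λ i → D i j))
      ≈⟨ -‿cong (laplace-interchange x y D) ⟩
    - laplace y (λ i → laplace x (D i))
      ≈⟨ ∑-neg (λ i → signed (toℕ i) (M (suc i) zero * det (suc n) (columnMinor M (suc i)))) ⟨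
    ∑[ i < suc n ] (- signed (toℕ i) (M (suc i) zero * det (suc n) (columnMinor M (suc i)))) ∎)
    where
    x y : Vector Carrier (suc n)
    x j = M zero (suc j)
    y i = M (suc i) zero
    D : Fin (suc n) → Fin (suc n) → Carrier
    D i j = det n (λ a b → M (suc (punchIn i a)) (suc (punchIn j b)))

  det-transpose : ∀ n (M : Matrix n) → det n (transpose M) ≈ det n M
  det-transpose zero    M = refl
  det-transpose (suc n) M = trans
    (laplace-congʳ (λ i → M i zero) (λ i → det-transpose n (columnMinor M i)))
    (sym (det-columnExpansion n M))

  swapAdjacent : ∀ {n} → Fin (suc n) → Fin (suc (suc n)) → Fin (suc (suc n))
  swapAdjacent zero          zero          = suc zero
  swapAdjacent zero          (suc zero)    = zero
  swapAdjacent zero          (suc (suc i)) = suc (suc i)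
  swapAdjacent {suc n} (suc k) zero          = zero
  swapAdjacent {suc n} (suc k) (suc i)       = suc (swapAdjacent k i)

  private
    swap₀-suc : ∀ {n} (a : Fin (suc n)) → swapAdjacent zero (suc a) ≡ punchIn (suc zero) a
    swap₀-suc zero    = ≡.refl
    swap₀-suc (suc a) = ≡.refl

    swap₀-punchIn₁ : ∀ {n} (a : Fin (suc n)) → swapAdjacent zero (punchIn (suc zero) a) ≡ suc a
    swap₀-punchIn₁ zero    = ≡.refl
    swap₀-punchIn₁ (suc a) = ≡.refl

    swap₀-punchIn : ∀ {n} (r : Fin (suc n)) (a : Fin (suc (suc n))) →
      swapAdjacent zero (punchIn (suc (suc r)) a) ≡ punchIn (suc (suc r)) (swapAdjacent zero a)
    swap₀-punchIn r zero          = ≡.refl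
    swap₀-punchIn r (suc zero)    = ≡.refl
    swap₀-punchIn r (suc (suc a)) = ≡.refl

    reindexRows : ∀ {m n} (A : Fin m → Fin n → Carrier) {σ τ : Fin n → Fin m} →
      (∀ a → σ a ≡ τ a) → (λ a → A (σ a)) ≈ᴹ (λ a → A (τ a))
    reindexRows A eq a b = reflexive (≡.cong (λ i → A i b) (eq a))

  det-swapAdjacentRows : ∀ n k (M : Matrix (suc (suc n))) →
    det (suc (suc n)) (M ∘ swapAdjacent k) ≈ - det (suc (suc n)) M
  det-swapAdjacentRows n zero M = begin
    det (suc (suc n)) M′
      ≈⟨ det-columnExpansion (suc n) M′ ⟩
    M₁₀ * det (suc n) (columnMinor M′ zero)
      + (- (M₀₀ * det (suc n) (columnMinor M′ (suc zero))) + rest M′)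
      ≈⟨ +-cong (*-congˡ (det-cong (suc n) (reindexRows tailColumns swap₀-suc)))
                (+-cong (-‿cong (*-congˡ (det-cong (suc n) (reindexRows tailColumns swap₀-punchIn₁))))
                        (rest-swapped n M)) ⟩
    M₁₀ * D₁ + (- (M₀₀ * D₀) + - rest M)
      ≈⟨ antisymmetric (M₁₀ * D₁) (M₀₀ * D₀) (rest M) ⟩
    - (M₀₀ * D₀ + (- (M₁₀ * D₁) + rest M))
      ≈⟨ -‿cong (det-columnExpansion (suc n) M) ⟨
    - det (suc (suc n)) M ∎
    where
    M′ = M ∘ swapAdjacent zero
    tailColumns : Fin (suc (suc n)) → Fin (suc n) → Carrier
    tailColumns i b = M i (suc b)
    M₀₀ M₁₀ D₀ D₁ : Carrier
    M₀₀ = M zero zero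
    M₁₀ = M (suc zero) zero
    D₀ = det (suc n) (columnMinor M zero)
    D₁ = det (suc n) (columnMinor M (suc zero))
    cofactor : ∀ {n} → Matrix (suc (suc n)) → Fin (suc (suc n)) → Carrier
    cofactor {n} N r = signed (toℕ r) (N r zero * det (suc n) (columnMinor N r))
    rest : ∀ {n} → Matrix (suc (suc n)) → Carrier
    rest {n} N = ∑[ r < n ] cofactor N (suc (suc r))
    antisymmetric : ∀ a b r → a + (- b + - r) ≈ - (b + (- a + r))
    antisymmetric a b r = begin
      a + (- b + - r)        ≈⟨ +-x∙yz≈y∙xz a (- b) (- r) ⟩
      - b + (a + - r)        ≈⟨ +-congˡ (+-congʳ (-‿involutive a)) ⟨
      - b + (- - a + - r)    ≈⟨ +-congˡ (-‿+-comm (- a) r) ⟩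
      - b + - (- a + r)      ≈⟨ -‿+-comm b (- a + r) ⟩
      - (b + (- a + r))      ∎
    rest-swapped : ∀ n (M : Matrix (suc (suc n))) → rest (M ∘ swapAdjacent zero) ≈ - rest M
    rest-swapped zero    M = sym -0#≈0#
    rest-swapped (suc n) M = trans (sum-cong-≋ swapped) (∑-neg (λ r → cofactor M (suc (suc r))))
      where
      swapped : ∀ r → cofactor (M ∘ swapAdjacent zero) (suc (suc r)) ≈ - cofactor M (suc (suc r))
      swapped r = trans
        (signed-cong (suc (suc (toℕ r))) (*-congˡ {M (suc (suc r)) zero} (trans
          (det-cong (suc (suc n)) (reindexRows (λ i b → M i (suc b)) (swap₀-punchIn r)))
          (det-swapAdjacentRows n zero (columnMinor M (suc (suc r)))))))
        (signed-*-negʳ (suc (suc (toℕ r))) _ _)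
  det-swapAdjacentRows (suc n) (suc k) M =
    trans (laplace-congʳ (M zero) (λ j → det-swapAdjacentRows n k (minor M j)))
          (laplace-negʳ (M zero) (λ j → det (suc (suc n)) (minor M j)))

  det-vanishingMinors : ∀ n (M : Matrix (suc n)) →
    (∀ j → det n (minor M j) ≈ 0#) → det (suc n) M ≈ 0#
  det-vanishingMinors n M = laplace-zeroʳ (M zero) (λ j → det n (minor M j))

  -- Adjacent row swaps move the repeated row away from row 0; then every minor repeats a row.
  det-equalRows : ∀ n (M : Matrix (suc n)) (i : Fin n) →
    (∀ j → M zero j ≈ M (suc i) j) → det (suc n) M ≈ 0#
  det-equalRows (suc zero) M zero e = begin
    M zero zero * det 1 (minor M zero) + (- (M zero (suc zero) * det 1 (minor M (suc zero))) + 0#)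
      ≈⟨ +-cong (*-cong (e zero) (det₁ (minor M zero))) (+-identityʳ _) ⟩
    M (suc zero) zero * M (suc zero) (suc zero) + - (M zero (suc zero) * det 1 (minor M (suc zero)))
      ≈⟨ +-congˡ (-‿cong (trans (*-cong (e (suc zero)) (det₁ (minor M (suc zero)))) (*-comm _ _))) ⟩
    M (suc zero) zero * M (suc zero) (suc zero) + - (M (suc zero) zero * M (suc zero) (suc zero))
      ≈⟨ -‿inverseʳ _ ⟩
    0# ∎
    where
    det₁ : ∀ A → det 1 A ≈ A zero zero
    det₁ A = trans (+-identityʳ _) (*-identityʳ _)
  det-equalRows (suc (suc n)) M zero e = begin
    det (suc (suc (suc n))) M
      ≈⟨ -‿involutive _ ⟨
    - - det (suc (suc (suc n))) M
      ≈⟨ -‿cong (det-swapAdjacentRows (suc n) (suc zero) M) ⟨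
    - det (suc (suc (suc n))) (M ∘ swapAdjacent (suc zero))
      ≈⟨ det-swapAdjacentRows (suc n) zero (M ∘ swapAdjacent (suc zero)) ⟨
    det (suc (suc (suc n))) (M ∘ swapAdjacent (suc zero) ∘ swapAdjacent zero)
      ≈⟨ det-vanishingMinors (suc (suc n)) M″ (λ j →
           det-equalRows (suc n) (minor M″ j) zero (λ k → e (punchIn j k))) ⟩
    0# ∎
    where
    M″ = M ∘ swapAdjacent (suc zero) ∘ swapAdjacent zero
  det-equalRows (suc n) M (suc i) e = begin
    det (suc (suc n)) M
      ≈⟨ -‿involutive _ ⟨
    - - det (suc (suc n)) M
      ≈⟨ -‿cong (det-swapAdjacentRows n zero M) ⟨
    - det (suc (suc n)) (M ∘ swapAdjacent zero)
      ≈⟨ -‿cong (det-vanishingMinors (suc n) M′ (λ j →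
           det-equalRows n (minor M′ j) i (λ k → e (punchIn j k)))) ⟩
    - 0#
      ≈⟨ -0#≈0# ⟩
    0# ∎
    where
    M′ = M ∘ swapAdjacent zero

  det-equalColumns : ∀ n (M : Matrix (suc n)) (i : Fin n) →
    (∀ r → M r zero ≈ M r (suc i)) → det (suc n) M ≈ 0#
  det-equalColumns n M i e = trans (sym (det-transpose (suc n) M)) (det-equalRows n (transpose M) i e)

  infixl 9 _[_]≔_
  _[_]≔_ : ∀ {n} → Matrix n → Fin n → Vector Carrier n → Matrix n
  M [ i ]≔ w = updateAt M i (const w)

  minor-[]≔ : ∀ {n} (M : Matrix (suc n)) i w j →
    minor (M [ suc i ]≔ w) j ≈ᴹ minor M j [ i ]≔ removeAt w j
  minor-[]≔ M i w j r k = reflexive (≡.cong-app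
    (map-updateAt-local {f = λ row → removeAt row j} {g = const w} {h = const (removeAt w j)}
                        (tail M) i ≡.refl r) k)

  []≔-updates : ∀ {n} (M : Matrix n) i w j → (M [ i ]≔ w) i j ≈ w j
  []≔-updates M i w j = reflexive (≡.cong-app (updateAt-updates i M) j)

  -- The terms in which w replaces two rows vanish by det-equalRows.
  det-rankOneUpdate : ∀ n (K : Matrix n) (l w : Vector Carrier n) →
    det n (λ i j → K i j + l i * w j) ≈ det n K + ∑[ i < n ] (l i * det n (K [ i ]≔ w))
  det-rankOneUpdate zero    K l w = sym (+-identityʳ 1#)
  det-rankOneUpdate (suc n) K l w = begin
    laplace x (λ j → det n (minor K′ j))
      ≈⟨ laplace-congʳ x (λ j → det-rankOneUpdate n (minor K j) (tail l) (removeAt w j)) ⟩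
    laplace x (λ j → D j + S j)
      ≈⟨ laplace-+ˡ (K zero) (λ j → l zero * w j) (λ j → D j + S j) ⟩
    laplace (K zero) (λ j → D j + S j) + laplace (λ j → l zero * w j) (λ j → D j + S j)
      ≈⟨ +-cong (laplace-+ʳ (K zero) D S)
                (trans (laplace-*ˡ (l zero) w (λ j → D j + S j)) (*-congˡ (laplace-+ʳ w D S))) ⟩
    (det (suc n) K + laplace (K zero) S) + l zero * (det (suc n) (K [ zero ]≔ w) + laplace w S)
      ≈⟨ +-cong (+-congˡ (expandUpdatedRows (K zero))) (*-congˡ (+-congˡ twiceUpdated≈0)) ⟩
    (det (suc n) K + T) + l zero * (det (suc n) (K [ zero ]≔ w) + 0#)
      ≈⟨ +-congˡ (*-congˡ (+-identityʳ _)) ⟩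
    (det (suc n) K + T) + l zero * det (suc n) (K [ zero ]≔ w)
      ≈⟨ +-xy∙z≈x∙zy (det (suc n) K) T _ ⟩
    det (suc n) K + (l zero * det (suc n) (K [ zero ]≔ w) + T) ∎
    where
    K′ : Matrix (suc n)
    K′ i j = K i j + l i * w j
    x : Vector Carrier (suc n)
    x j = K zero j + l zero * w j
    D S : Vector Carrier (suc n)
    D j = det n (minor K j)
    S j = ∑[ r < n ] (l (suc r) * det n (minor K j [ r ]≔ removeAt w j))
    T : Carrier
    T = ∑[ r < n ] (l (suc r) * det (suc n) (K [ suc r ]≔ w))
    expandUpdatedRows : ∀ y →
      laplace y S ≈ ∑[ r < n ] (l (suc r) * det (suc n) ((y Vector.∷ tail K) [ suc r ]≔ w))
    expandUpdatedRows y = trans (laplace-∑ʳ y (tail l) (λ r j → det n (minor K j [ r ]≔ removeAt w j)))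
      (sum-cong-≋ λ r → *-congˡ (laplace-congʳ y (λ j →
        det-cong n (λ a b → sym (minor-[]≔ (y Vector.∷ tail K) r w j a b)))))
    twiceUpdated≈0 : laplace w S ≈ 0#
    twiceUpdated≈0 = trans (expandUpdatedRows w) (∑-zero λ r → trans (*-congˡ (repeated r)) (zeroʳ _))
      where
      repeated : ∀ r → det (suc n) ((w Vector.∷ tail K) [ suc r ]≔ w) ≈ 0#
      repeated r = det-equalRows n ((w Vector.∷ tail K) [ suc r ]≔ w) r
        (λ j → sym ([]≔-updates (w Vector.∷ tail K) (suc r) w j))

  det-addFirstRowMultiples : ∀ n (M C : Matrix (suc n)) (l : Vector Carrier n) →
    (∀ j → C zero j ≈ M zero j) → (∀ i j → C (suc i) j ≈ M (suc i) j + l i * M zero j) →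
    det (suc n) C ≈ det (suc n) M
  det-addFirstRowMultiples n M C l first others = begin
    det (suc n) C
      ≈⟨ det-cong (suc n) C≈ ⟩
    det (suc n) (λ i j → M i j + l′ i * M zero j)
      ≈⟨ det-rankOneUpdate (suc n) M l′ (M zero) ⟩
    det (suc n) M + ∑[ i < suc n ] (l′ i * det (suc n) (M [ i ]≔ M zero))
      ≈⟨ +-congˡ (∑-zero vanish) ⟩
    det (suc n) M + 0#
      ≈⟨ +-identityʳ _ ⟩
    det (suc n) M ∎
    where
    l′ : Vector Carrier (suc n)
    l′ = 0# Vector.∷ l
    C≈ : C ≈ᴹ (λ i j → M i j + l′ i * M zero j)
    C≈ zero    j = trans (first j) (sym (trans (+-congˡ (zeroˡ _)) (+-identityʳ _)))
    C≈ (suc i) j = others i j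
    vanish : ∀ i → l′ i * det (suc n) (M [ i ]≔ M zero) ≈ 0#
    vanish zero    = zeroˡ _
    vanish (suc r) = trans (*-congˡ (det-equalRows n (M [ suc r ]≔ M zero) r λ j →
      sym ([]≔-updates M (suc r) (M zero) j))) (zeroʳ _)

  infixl 7 _*ᴹ_
  _*ᴹ_ : ∀ {m n p} → (Fin m → Fin n → Carrier) → (Fin n → Fin p → Carrier) → Fin m → Fin p → Carrier
  _*ᴹ_ {n = n} A B i j = ∑[ k < n ] (A i k * B k j)

  record LowerUnitriangular {n} (L : Matrix n) : Set ℓ where
    field
      diagonal : ∀ i → L i i ≈ 1#
      upper    : ∀ i j → i Fin.< j → L i j ≈ 0#

  LowerUnitriangular-tail : ∀ {n} {L : Matrix (suc n)} →
    LowerUnitriangular L → LowerUnitriangular (λ a b → L (suc a) (suc b))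
  LowerUnitriangular-tail unit = record
    { diagonal = λ i → diagonal (suc i) ; upper = λ i j i<j → upper (suc i) (suc j) (s≤s i<j) }
    where open LowerUnitriangular unit

  det-lowerUnitriangular-*ᴹ : ∀ n (L M : Matrix n) → LowerUnitriangular L → det n (L *ᴹ M) ≈ det n M
  det-lowerUnitriangular-*ᴹ zero    L M _ = refl
  det-lowerUnitriangular-*ᴹ (suc n) L M unit = begin
    det (suc n) (L *ᴹ M)
      ≈⟨ det-addFirstRowMultiples n N (L *ᴹ M) (λ i → L (suc i) zero) firstRow (λ i j → +-comm _ _) ⟩
    det (suc n) N
      ≈⟨ laplace-congʳ (M zero) (λ j →
           det-lowerUnitriangular-*ᴹ n L′ (minor M j) (LowerUnitriangular-tail unit)) ⟩
    det (suc n) M ∎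
    where
    open LowerUnitriangular unit
    L′ : Matrix n
    L′ a b = L (suc a) (suc b)
    N : Matrix (suc n)
    N = M zero Vector.∷ (L′ *ᴹ tail M)
    firstRow : ∀ j → (L *ᴹ M) zero j ≈ M zero j
    firstRow j = begin
      L zero zero * M zero j + ∑[ k < n ] (L zero (suc k) * M (suc k) j)
        ≈⟨ +-cong (trans (*-congʳ (diagonal zero)) (*-identityˡ _))
                  (∑-zero λ k → trans (*-congʳ (upper zero (suc k) (s≤s z≤n))) (zeroˡ _)) ⟩
      M zero j + 0#
        ≈⟨ +-identityʳ _ ⟩
      M zero j ∎

  det-*ᴹ-lowerUnitriangular : ∀ n (M L : Matrix n) → LowerUnitriangular L → det n (M *ᴹ L) ≈ det n M
  det-*ᴹ-lowerUnitriangular zero    M L _ = refl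
  det-*ᴹ-lowerUnitriangular (suc n) M L unit = begin
    det (suc n) (M *ᴹ L)
      ≈⟨ det-columnExpansion n (M *ᴹ L) ⟩
    laplace (λ r → (M *ᴹ L) r zero) (λ r → det n (columnMinor (M *ᴹ L) r))
      ≈⟨ laplace-cong firstColumn (λ r → trans (det-cong n (otherColumns r))
           (det-*ᴹ-lowerUnitriangular n (columnMinor M r) L′ (LowerUnitriangular-tail unit))) ⟩
    laplace (λ r → M r zero + ∑[ k < n ] (L (suc k) zero * M r (suc k))) D
      ≈⟨ laplace-+ˡ (λ r → M r zero) (λ r → ∑[ k < n ] (L (suc k) zero * M r (suc k))) D ⟩
    laplace (λ r → M r zero) D + laplace (λ r → ∑[ k < n ] (L (suc k) zero * M r (suc k))) D
      ≈⟨ +-cong (sym (det-columnExpansion n M))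
                (trans (laplace-∑ˡ (λ k → L (suc k) zero) (λ k r → M r (suc k)) D)
                       (∑-zero λ k → trans (*-congˡ (repeatedColumn k)) (zeroʳ _))) ⟩
    det (suc n) M + 0#
      ≈⟨ +-identityʳ _ ⟩
    det (suc n) M ∎
    where
    open LowerUnitriangular unit
    L′ : Matrix n
    L′ a b = L (suc a) (suc b)
    D : Vector Carrier (suc n)
    D r = det n (columnMinor M r)
    firstColumn : ∀ r → (M *ᴹ L) r zero ≈ M r zero + ∑[ k < n ] (L (suc k) zero * M r (suc k))
    firstColumn r = +-cong (trans (*-congˡ (diagonal zero)) (*-identityʳ _))
                           (sum-cong-≋ λ k → *-comm (M r (suc k)) (L (suc k) zero))
    otherColumns : ∀ r → columnMinor (M *ᴹ L) r ≈ᴹ columnMinor M r *ᴹ L′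
    otherColumns r a b = trans (+-congʳ (trans (*-congˡ (upper zero (suc b) (s≤s z≤n))) (zeroʳ _))) (+-identityˡ _)
    repeatedColumn : ∀ k → laplace (λ r → M r (suc k)) D ≈ 0#
    repeatedColumn k = trans (sym (det-columnExpansion n (λ r → M r (suc k) Vector.∷ tail (M r))))
                             (det-equalColumns n (λ r → M r (suc k) Vector.∷ tail (M r)) k (λ r → refl))

  det-lowerTriangular : ∀ n (M : Matrix n) → (∀ i j → i Fin.< j → M i j ≈ 0#) →
    det n M ≈ product (λ i → M i i)
  det-lowerTriangular zero    M lower = refl
  det-lowerTriangular (suc n) M lower = begin
    M zero zero * det n (minor M zero) + ∑[ j < n ] signed (suc (toℕ j)) (M zero (suc j) * det n (minor M (suc j)))
      ≈⟨ +-cong (*-congˡ (det-lowerTriangular n (minor M zero) (λ i j i<j → lower (suc i) (suc j) (s≤s i<j))))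
                (∑-zero λ j → trans
                  (signed-cong (suc (toℕ j)) (trans (*-congʳ (lower zero (suc j) (s≤s z≤n))) (zeroˡ _)))
                  (signed-zero (suc (toℕ j)))) ⟩
    M zero zero * product (λ i → M (suc i) (suc i)) + 0#
      ≈⟨ +-identityʳ _ ⟩
    product (λ i → M i i) ∎

  UpperTriangular : ∀ {n} → Matrix n → Set ℓ
  UpperTriangular M = ∀ i j → j Fin.< i → M i j ≈ 0#

  det-upperTriangular : ∀ n (M : Matrix n) → UpperTriangular M → det n M ≈ product (λ i → M i i)
  det-upperTriangular n M upper =
    trans (sym (det-transpose n M)) (det-lowerTriangular n (transpose M) (λ i j → upper j i))

  δ : ∀ {n} → Fin n → Fin n → Carrier
  δ zero    zero    = 1#
  δ zero    (suc j) = 0#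
  δ (suc i) zero    = 0#
  δ (suc i) (suc j) = δ i j

  δ-refl : ∀ {n} (i : Fin n) → δ i i ≡ 1#
  δ-refl zero    = ≡.refl
  δ-refl (suc i) = δ-refl i

  δ-≢ : ∀ {n} {i j : Fin n} → i ≢ j → δ i j ≡ 0#
  δ-≢ {i = zero}  {zero}  i≢j = ⊥-elim (i≢j ≡.refl)
  δ-≢ {i = zero}  {suc j} i≢j = ≡.refl
  δ-≢ {i = suc i} {zero}  i≢j = ≡.refl
  δ-≢ {i = suc i} {suc j} i≢j = δ-≢ (i≢j ∘ ≡.cong suc)

  δ-sym : ∀ {n} (i j : Fin n) → δ i j ≡ δ j i
  δ-sym zero    zero    = ≡.refl
  δ-sym zero    (suc j) = ≡.refl
  δ-sym (suc i) zero    = ≡.refl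
  δ-sym (suc i) (suc j) = δ-sym i j

  *ᴹ-δ : ∀ {m n} (A : Fin m → Fin n → Carrier) i j → ∑[ k < n ] (A i k * δ k j) ≈ A i j
  *ᴹ-δ {n = suc n} A i zero = begin
    A i zero * 1# + ∑[ k < n ] (A i (suc k) * 0#)
      ≈⟨ +-cong (*-identityʳ _) (∑-zero λ k → zeroʳ (A i (suc k))) ⟩
    A i zero + 0#
      ≈⟨ +-identityʳ _ ⟩
    A i zero ∎
  *ᴹ-δ {n = suc n} A i (suc j) = begin
    A i zero * 0# + ∑[ k < n ] (A i (suc k) * δ k j)
      ≈⟨ +-cong (zeroʳ _) (*ᴹ-δ (λ a k → A a (suc k)) i j) ⟩
    0# + A i (suc j)
      ≈⟨ +-identityˡ _ ⟩
    A i (suc j) ∎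

  δ-*ᴹ : ∀ {m n} (A : Fin m → Fin n → Carrier) i j → ∑[ k < m ] (δ i k * A k j) ≈ A i j
  δ-*ᴹ A i j =
    trans (sum-cong-≋ λ k → trans (*-comm _ _) (*-congˡ (reflexive (δ-sym i k)))) (*ᴹ-δ (transpose A) j i)

  infixl 6 _-ᵈ_
  _-ᵈ_ : ∀ {n} → Matrix n → Carrier → Matrix n
  (A -ᵈ x) i j = A i j - x * δ i j

  *ᴹ-ᵈ : ∀ {n} (L A : Matrix n) x i j → (L *ᴹ (A -ᵈ x)) i j ≈ (L *ᴹ A) i j - x * L i j
  *ᴹ-ᵈ {n} L A x i j = begin
    ∑[ k < n ] (L i k * (A k j - x * δ k j))
      ≈⟨ sum-cong-≋ (λ k → distribute (L i k) (A k j) (δ k j)) ⟩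
    ∑[ k < n ] (L i k * A k j - x * (L i k * δ k j))
      ≈⟨ ∑-sub-*ˡ x (λ k → L i k * A k j) (λ k → L i k * δ k j) ⟩
    (L *ᴹ A) i j - x * ∑[ k < n ] (L i k * δ k j)
      ≈⟨ +-congˡ (-‿cong (*-congˡ (*ᴹ-δ L i j))) ⟩
    (L *ᴹ A) i j - x * L i j ∎
    where
    distribute : ∀ l a d → l * (a - x * d) ≈ l * a - x * (l * d)
    distribute l a d = trans (distribˡ l a (- (x * d)))
      (+-congˡ (trans (sym (-‿distribʳ-* l (x * d))) (-‿cong (x∙yz≈y∙xz l x d))))

  ᵈ-*ᴹ : ∀ {n} (B L : Matrix n) x i j → ((B -ᵈ x) *ᴹ L) i j ≈ (B *ᴹ L) i j - x * L i j
  ᵈ-*ᴹ {n} B L x i j = begin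
    ∑[ k < n ] ((B i k - x * δ i k) * L k j)
      ≈⟨ sum-cong-≋ (λ k → distribute (B i k) (δ i k) (L k j)) ⟩
    ∑[ k < n ] (B i k * L k j - x * (δ i k * L k j))
      ≈⟨ ∑-sub-*ˡ x (λ k → B i k * L k j) (λ k → δ i k * L k j) ⟩
    (B *ᴹ L) i j - x * ∑[ k < n ] (δ i k * L k j)
      ≈⟨ +-congˡ (-‿cong (*-congˡ (δ-*ᴹ L i j))) ⟩
    (B *ᴹ L) i j - x * L i j ∎
    where
    distribute : ∀ b d l → (b - x * d) * l ≈ b * l - x * (d * l)
    distribute b d l = trans (distribʳ l b (- (x * d)))
      (+-congˡ (trans (sym (-‿distribˡ-* (x * d) l)) (-‿cong (*-assoc x d l))))

  det-similar : ∀ n (L A B : Matrix n) → LowerUnitriangular L → L *ᴹ A ≈ᴹ B *ᴹ L → det n A ≈ det n B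
  det-similar n L A B unit LA≈BL = begin
    det n A         ≈⟨ det-lowerUnitriangular-*ᴹ n L A unit ⟨
    det n (L *ᴹ A)  ≈⟨ det-cong n LA≈BL ⟩
    det n (B *ᴹ L)  ≈⟨ det-*ᴹ-lowerUnitriangular n B L unit ⟩
    det n B         ∎

  det-similar-ᵈ : ∀ n (L A B : Matrix n) → LowerUnitriangular L → L *ᴹ A ≈ᴹ B *ᴹ L →
    ∀ x → det n (A -ᵈ x) ≈ det n (B -ᵈ x)
  det-similar-ᵈ n L A B unit LA≈BL x = det-similar n L (A -ᵈ x) (B -ᵈ x) unit λ i j → begin
    (L *ᴹ (A -ᵈ x)) i j       ≈⟨ *ᴹ-ᵈ L A x i j ⟩
    (L *ᴹ A) i j - x * L i j  ≈⟨ +-congʳ (LA≈BL i j) ⟩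
    (B *ᴹ L) i j - x * L i j  ≈⟨ ᵈ-*ᴹ B L x i j ⟨
    ((B -ᵈ x) *ᴹ L) i j       ∎

  det-upperTriangular-ᵈ : ∀ n (B : Matrix n) d → UpperTriangular B → (∀ i → B i i ≈ d) →
    ∀ x → det n (B -ᵈ x) ≈ (d - x) ^ n
  det-upperTriangular-ᵈ n B d upper diagonal x = begin
    det n (B -ᵈ x)                     ≈⟨ det-upperTriangular n (B -ᵈ x) upper-ᵈ ⟩
    product (λ i → B i i - x * δ i i)  ≈⟨ product-cong (λ i → +-cong (diagonal i) (-‿cong (x*δᵢᵢ≈x i))) ⟩
    product (replicate n (d - x))      ≈⟨ product-replicate n ⟩
    (d - x) ^ n                        ∎
    where
    x*δᵢᵢ≈x : ∀ i → x * δ i i ≈ x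
    x*δᵢᵢ≈x i = trans (*-congˡ (reflexive (δ-refl i))) (*-identityʳ x)
    upper-ᵈ : UpperTriangular (B -ᵈ x)
    upper-ᵈ i j j<i = begin
      B i j - x * δ i j  ≈⟨ +-cong (upper i j j<i) (-‿cong (trans (*-congˡ (reflexive δᵢⱼ≡0)) (zeroʳ x))) ⟩
      0# - 0#            ≈⟨ -‿inverseʳ 0# ⟩
      0#                 ∎
      where
      δᵢⱼ≡0 : δ i j ≡ 0#
      δᵢⱼ≡0 = δ-≢ (λ i≡j → <⇒≢ j<i (≡.sym i≡j))

coeff-+P : ∀ p q k → coeff (p +P q) k ≡ coeff p k +ℤ coeff q k
coeff-+P []      q       k       = ≡.sym (ℤ.+-identityˡ (coeff q k))
coeff-+P (a ∷ p) []      k       = ≡.sym (ℤ.+-identityʳ (coeff (a ∷ p) k))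
coeff-+P (a ∷ p) (b ∷ q) zero    = ≡.refl
coeff-+P (a ∷ p) (b ∷ q) (suc k) = coeff-+P p q k

coeff--P : ∀ p k → coeff (-P p) k ≡ ℤ.- coeff p k
coeff--P []      k       = ≡.refl
coeff--P (a ∷ p) zero    = ≡.refl
coeff--P (a ∷ p) (suc k) = coeff--P p k

scale : ℤ → Poly → Poly
scale a = map (a *ℤ_)

coeff-scale : ∀ a p k → coeff (scale a p) k ≡ a *ℤ coeff p k
coeff-scale a []      k       = ≡.sym (ℤ.*-zeroʳ a)
coeff-scale a (b ∷ p) zero    = ≡.refl
coeff-scale a (b ∷ p) (suc k) = coeff-scale a p k

shift : Poly → Poly
shift p = + 0 ∷ p

scaledBinomial : ℕ → ℕ → ℕ → ℕ
scaledBinomial c k j = (k C j) ℕ.* c ℕ.^ (k ∸ j)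

scaledBinomial-zero : ∀ c k → c ℕ.* scaledBinomial c k zero ≡ scaledBinomial c (suc k) zero
scaledBinomial-zero c k =
  ≡.trans (≡.cong (c ℕ.*_) (ℕ.*-identityˡ (c ℕ.^ k))) (≡.sym (ℕ.*-identityˡ (c ℕ.^ suc k)))

scaledBinomial-pascal : ∀ c k j →
  c ℕ.* scaledBinomial c k (suc j) ℕ.+ scaledBinomial c k j ≡ scaledBinomial c (suc k) (suc j)
scaledBinomial-pascal c k j with j ℕ.<? k
... | yes j<k = begin
  c ℕ.* ((k C suc j) ℕ.* c ℕ.^ (k ∸ suc j)) ℕ.+ (k C j) ℕ.* c ℕ.^ (k ∸ j)
    ≡⟨ ≡.cong (λ n → c ℕ.* ((k C suc j) ℕ.* c ℕ.^ (k ∸ suc j)) ℕ.+ (k C j) ℕ.* c ℕ.^ n)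
              k∸j≡1+k∸[1+j] ⟩
  c ℕ.* ((k C suc j) ℕ.* c ℕ.^ (k ∸ suc j)) ℕ.+ (k C j) ℕ.* (c ℕ.* c ℕ.^ (k ∸ suc j))
    ≡⟨ factor (k C j) (k C suc j) c (c ℕ.^ (k ∸ suc j)) ⟩
  ((k C j) ℕ.+ (k C suc j)) ℕ.* (c ℕ.* c ℕ.^ (k ∸ suc j))
    ≡⟨ ≡.cong₂ ℕ._*_ (nCk+nC[k+1]≡[n+1]C[k+1] k j) (≡.cong (c ℕ.^_) (≡.sym k∸j≡1+k∸[1+j])) ⟩
  (suc k C suc j) ℕ.* c ℕ.^ (k ∸ j) ∎
  where
  open ≡.≡-Reasoning
  k∸j≡1+k∸[1+j] : k ∸ j ≡ suc (k ∸ suc j)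
  k∸j≡1+k∸[1+j] = ℕ.+-∸-assoc 1 j<k
  factor : ∀ a b c p → c ℕ.* (b ℕ.* p) ℕ.+ a ℕ.* (c ℕ.* p) ≡ (a ℕ.+ b) ℕ.* (c ℕ.* p)
  factor = solve-∀ℕ
... | no j≮k = begin
  c ℕ.* ((k C suc j) ℕ.* c ℕ.^ (k ∸ suc j)) ℕ.+ (k C j) ℕ.* c ℕ.^ (k ∸ j)
    ≡⟨ ≡.cong (λ n → c ℕ.* (n ℕ.* c ℕ.^ (k ∸ suc j)) ℕ.+ (k C j) ℕ.* c ℕ.^ (k ∸ j)) kC[1+j]≡0 ⟩
  c ℕ.* 0 ℕ.+ (k C j) ℕ.* c ℕ.^ (k ∸ j)
    ≡⟨ factor c (k C j) (c ℕ.^ (k ∸ j)) ⟩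
  ((k C j) ℕ.+ 0) ℕ.* c ℕ.^ (k ∸ j)
    ≡⟨ ≡.cong (λ n → ((k C j) ℕ.+ n) ℕ.* c ℕ.^ (k ∸ j)) kC[1+j]≡0 ⟨
  ((k C j) ℕ.+ (k C suc j)) ℕ.* c ℕ.^ (k ∸ j)
    ≡⟨ ≡.cong (ℕ._* c ℕ.^ (k ∸ j)) (nCk+nC[k+1]≡[n+1]C[k+1] k j) ⟩
  (suc k C suc j) ℕ.* c ℕ.^ (k ∸ j) ∎
  where
  open ≡.≡-Reasoning
  kC[1+j]≡0 : k C suc j ≡ 0
  kC[1+j]≡0 = k>n⇒nCk≡0 (s≤s (ℕ.≮⇒≥ j≮k))
  factor : ∀ c a p → c ℕ.* 0 ℕ.+ a ℕ.* p ≡ (a ℕ.+ 0) ℕ.* p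
  factor = solve-∀ℕ

module PolynomialsModulo (m : ℤ) where

  infix 4 _≡ₘ_ _≈ₚ_

  record _≡ₘ_ (a b : ℤ) : Set where
    constructor ≡ₘ-intro
    field divides-difference : m ∣ a -ℤ b

  ≡⇒≡ₘ : ∀ {a b} → a ≡ b → a ≡ₘ b
  ≡⇒≡ₘ {a} ≡.refl = ≡ₘ-intro (divides (+ 0) (≡.trans (ℤ.+-inverseʳ a) (≡.sym (ℤ.*-zeroˡ m))))

  ≡ₘ-refl : ∀ {a} → a ≡ₘ a
  ≡ₘ-refl = ≡⇒≡ₘ ≡.refl

  ≡ₘ-sym : ∀ {a b} → a ≡ₘ b → b ≡ₘ a
  ≡ₘ-sym {a} {b} (≡ₘ-intro d) = ≡ₘ-intro (≡.subst (m ∣_) (negate-difference a b) (∣m⇒∣-m d))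
    where
    negate-difference : ∀ a b → ℤ.- (a -ℤ b) ≡ b -ℤ a
    negate-difference = solve-∀

  ≡ₘ-trans : ∀ {a b c} → a ≡ₘ b → b ≡ₘ c → a ≡ₘ c
  ≡ₘ-trans {a} {b} {c} (≡ₘ-intro d) (≡ₘ-intro e) =
    ≡ₘ-intro (≡.subst (m ∣_) (telescope a b c) (∣m∣n⇒∣m+n d e))
    where
    telescope : ∀ a b c → (a -ℤ b) +ℤ (b -ℤ c) ≡ a -ℤ c
    telescope = solve-∀

  +-cong-≡ₘ : ∀ {a b c d} → a ≡ₘ b → c ≡ₘ d → a +ℤ c ≡ₘ b +ℤ d
  +-cong-≡ₘ {a} {b} {c} {d} (≡ₘ-intro e) (≡ₘ-intro f) =
    ≡ₘ-intro (≡.subst (m ∣_) (regroup a b c d) (∣m∣n⇒∣m+n e f))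
    where
    regroup : ∀ a b c d → (a -ℤ b) +ℤ (c -ℤ d) ≡ (a +ℤ c) -ℤ (b +ℤ d)
    regroup = solve-∀

  *-cong-≡ₘ : ∀ {a b c d} → a ≡ₘ b → c ≡ₘ d → a *ℤ c ≡ₘ b *ℤ d
  *-cong-≡ₘ {a} {b} {c} {d} (≡ₘ-intro e) (≡ₘ-intro f) =
    ≡ₘ-intro (≡.subst (m ∣_) (regroup a b c d) (∣m∣n⇒∣m+n (∣n⇒∣m*n c e) (∣n⇒∣m*n b f)))
    where
    regroup : ∀ a b c d → c *ℤ (a -ℤ b) +ℤ b *ℤ (c -ℤ d) ≡ a *ℤ c -ℤ b *ℤ d
    regroup = solve-∀

  neg-cong-≡ₘ : ∀ {a b} → a ≡ₘ b → ℤ.- a ≡ₘ ℤ.- b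
  neg-cong-≡ₘ {a} {b} (≡ₘ-intro e) = ≡ₘ-intro (≡.subst (m ∣_) (regroup a b) (∣m⇒∣-m e))
    where
    regroup : ∀ a b → ℤ.- (a -ℤ b) ≡ ℤ.- a -ℤ ℤ.- b
    regroup = solve-∀

  ≡ₘ-setoid : Setoid 0ℓ 0ℓ
  ≡ₘ-setoid = record
    { Carrier = ℤ
    ; _≈_ = _≡ₘ_
    ; isEquivalence = record { refl = ≡ₘ-refl ; sym = ≡ₘ-sym ; trans = ≡ₘ-trans }
    }

  module ≡ₘ-Reasoning = SetoidReasoning ≡ₘ-setoid

  record _≈ₚ_ (p q : Poly) : Set where
    constructor coeffwise
    field coeff-≡ₘ : ∀ k → coeff p k ≡ₘ coeff q k
  open _≈ₚ_ public

  coeffwise-≡ : ∀ {p q} → (∀ k → coeff p k ≡ coeff q k) → p ≈ₚ q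
  coeffwise-≡ e = coeffwise (λ k → ≡⇒≡ₘ (e k))

  ≈ₚ-refl : ∀ {p} → p ≈ₚ p
  ≈ₚ-refl = coeffwise-≡ (λ k → ≡.refl)

  ≈ₚ-sym : ∀ {p q} → p ≈ₚ q → q ≈ₚ p
  ≈ₚ-sym (coeffwise e) = coeffwise (λ k → ≡ₘ-sym (e k))

  ≈ₚ-trans : ∀ {p q r} → p ≈ₚ q → q ≈ₚ r → p ≈ₚ r
  ≈ₚ-trans (coeffwise e) (coeffwise f) = coeffwise (λ k → ≡ₘ-trans (e k) (f k))

  ≈ₚ-isEquivalence : IsEquivalence _≈ₚ_
  ≈ₚ-isEquivalence = record { refl = ≈ₚ-refl ; sym = ≈ₚ-sym ; trans = ≈ₚ-trans }

  ∷-cong : ∀ {a b p q} → a ≡ₘ b → p ≈ₚ q → (a ∷ p) ≈ₚ (b ∷ q)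
  ∷-cong e (coeffwise f) = coeffwise λ { zero → e ; (suc k) → f k }

  +P-cong : ∀ {p p′ q q′} → p ≈ₚ p′ → q ≈ₚ q′ → p +P q ≈ₚ p′ +P q′
  +P-cong {p} {p′} {q} {q′} (coeffwise e) (coeffwise f) = coeffwise λ k →
    ≡.subst₂ _≡ₘ_ (≡.sym (coeff-+P p q k)) (≡.sym (coeff-+P p′ q′ k)) (+-cong-≡ₘ (e k) (f k))

  -P-cong : ∀ {p q} → p ≈ₚ q → -P p ≈ₚ -P q
  -P-cong {p} {q} (coeffwise e) = coeffwise λ k →
    ≡.subst₂ _≡ₘ_ (≡.sym (coeff--P p k)) (≡.sym (coeff--P q k)) (neg-cong-≡ₘ (e k))

  scale-cong : ∀ a {p q} → p ≈ₚ q → scale a p ≈ₚ scale a q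
  scale-cong a {p} {q} (coeffwise e) = coeffwise λ k →
    ≡.subst₂ _≡ₘ_ (≡.sym (coeff-scale a p k)) (≡.sym (coeff-scale a q k)) (*-cong-≡ₘ (≡ₘ-refl {a}) (e k))

  +P-assoc : ∀ p q r → (p +P q) +P r ≈ₚ p +P (q +P r)
  +P-assoc p q r = coeffwise-≡ λ k → begin
    coeff ((p +P q) +P r) k                ≡⟨ coeff-+P (p +P q) r k ⟩
    coeff (p +P q) k +ℤ coeff r k         ≡⟨ ≡.cong (_+ℤ coeff r k) (coeff-+P p q k) ⟩
    coeff p k +ℤ coeff q k +ℤ coeff r k  ≡⟨ ℤ.+-assoc (coeff p k) (coeff q k) (coeff r k) ⟩
    coeff p k +ℤ (coeff q k +ℤ coeff r k) ≡⟨ ≡.cong (coeff p k +ℤ_) (coeff-+P q r k) ⟨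
    coeff p k +ℤ coeff (q +P r) k         ≡⟨ coeff-+P p (q +P r) k ⟨
    coeff (p +P (q +P r)) k                ∎
    where open ≡.≡-Reasoning

  +P-comm : ∀ p q → p +P q ≈ₚ q +P p
  +P-comm p q = coeffwise-≡ λ k →
    ≡.trans (coeff-+P p q k) (≡.trans (ℤ.+-comm (coeff p k) (coeff q k)) (≡.sym (coeff-+P q p k)))

  +P-identityʳ : ∀ p → p +P [] ≈ₚ p
  +P-identityʳ p = coeffwise-≡ λ k → ≡.trans (coeff-+P p [] k) (ℤ.+-identityʳ (coeff p k))

  -P-inverseˡ : ∀ p → (-P p) +P p ≈ₚ []
  -P-inverseˡ p = coeffwise-≡ λ k →
    ≡.trans (coeff-+P (-P p) p k) (≡.trans (≡.cong (_+ℤ coeff p k) (coeff--P p k)) (ℤ.+-inverseˡ (coeff p k)))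

  -P-inverseʳ : ∀ p → p +P (-P p) ≈ₚ []
  -P-inverseʳ p = ≈ₚ-trans (+P-comm p (-P p)) (-P-inverseˡ p)

  +P-isCommutativeMonoid : IsCommutativeMonoid _≈ₚ_ _+P_ []
  +P-isCommutativeMonoid = record
    { isMonoid = record
      { isSemigroup = record
        { isMagma = record { isEquivalence = ≈ₚ-isEquivalence ; ∙-cong = +P-cong }
        ; assoc = +P-assoc }
      ; identity = (λ p → ≈ₚ-refl) , +P-identityʳ }
    ; comm = +P-comm }

  +P-commutativeMonoid : CommutativeMonoid 0ℓ 0ℓ
  +P-commutativeMonoid = record { isCommutativeMonoid = +P-isCommutativeMonoid }

  open import Algebra.Properties.CommutativeSemigroup (CommutativeMonoid.commutativeSemigroup +P-commutativeMonoid)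
    using (interchange; x∙yz≈y∙xz)

  shift-cong : ∀ {p q} → p ≈ₚ q → shift p ≈ₚ shift q
  shift-cong = ∷-cong ≡ₘ-refl

  shift-[] : shift [] ≈ₚ []
  shift-[] = coeffwise-≡ λ { zero → ≡.refl ; (suc k) → ≡.refl }

  scale-+P : ∀ a p q → scale a (p +P q) ≈ₚ scale a p +P scale a q
  scale-+P a p q = coeffwise-≡ λ k → begin
    coeff (scale a (p +P q)) k                      ≡⟨ coeff-scale a (p +P q) k ⟩
    a *ℤ coeff (p +P q) k                           ≡⟨ ≡.cong (a *ℤ_) (coeff-+P p q k) ⟩
    a *ℤ (coeff p k +ℤ coeff q k)                   ≡⟨ ℤ.*-distribˡ-+ a (coeff p k) (coeff q k) ⟩
    a *ℤ coeff p k +ℤ a *ℤ coeff q k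
      ≡⟨ ≡.cong₂ _+ℤ_ (coeff-scale a p k) (coeff-scale a q k) ⟨
    coeff (scale a p) k +ℤ coeff (scale a q) k      ≡⟨ coeff-+P (scale a p) (scale a q) k ⟨
    coeff (scale a p +P scale a q) k                ∎
    where open ≡.≡-Reasoning

  scale-distribʳ : ∀ a b p → scale (a +ℤ b) p ≈ₚ scale a p +P scale b p
  scale-distribʳ a b p = coeffwise-≡ λ k → begin
    coeff (scale (a +ℤ b) p) k                      ≡⟨ coeff-scale (a +ℤ b) p k ⟩
    (a +ℤ b) *ℤ coeff p k                           ≡⟨ ℤ.*-distribʳ-+ (coeff p k) a b ⟩
    a *ℤ coeff p k +ℤ b *ℤ coeff p k
      ≡⟨ ≡.cong₂ _+ℤ_ (coeff-scale a p k) (coeff-scale b p k) ⟨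
    coeff (scale a p) k +ℤ coeff (scale b p) k      ≡⟨ coeff-+P (scale a p) (scale b p) k ⟨
    coeff (scale a p +P scale b p) k                ∎
    where open ≡.≡-Reasoning

  scale-scale : ∀ a b p → scale (a *ℤ b) p ≈ₚ scale a (scale b p)
  scale-scale a b p = coeffwise-≡ λ k → begin
    coeff (scale (a *ℤ b) p) k      ≡⟨ coeff-scale (a *ℤ b) p k ⟩
    a *ℤ b *ℤ coeff p k             ≡⟨ ℤ.*-assoc a b (coeff p k) ⟩
    a *ℤ (b *ℤ coeff p k)           ≡⟨ ≡.cong (a *ℤ_) (coeff-scale b p k) ⟨
    a *ℤ coeff (scale b p) k        ≡⟨ coeff-scale a (scale b p) k ⟨
    coeff (scale a (scale b p)) k   ∎
    where open ≡.≡-Reasoning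

  scale-zero : ∀ p → scale (+ 0) p ≈ₚ []
  scale-zero p = coeffwise-≡ λ k → ≡.trans (coeff-scale (+ 0) p k) (ℤ.*-zeroˡ (coeff p k))

  scale-one : ∀ p → scale (+ 1) p ≈ₚ p
  scale-one p = coeffwise-≡ λ k → ≡.trans (coeff-scale (+ 1) p k) (ℤ.*-identityˡ (coeff p k))

  scale-shift : ∀ a p → scale a (shift p) ≈ₚ shift (scale a p)
  scale-shift a p = ∷-cong (≡⇒≡ₘ (ℤ.*-zeroʳ a)) ≈ₚ-refl

  *P-zeroʳ : ∀ p → p *P [] ≈ₚ []
  *P-zeroʳ []      = ≈ₚ-refl
  *P-zeroʳ (a ∷ p) = ≈ₚ-trans (shift-cong (*P-zeroʳ p)) shift-[]

  *P-congˡ : ∀ p {q q′} → q ≈ₚ q′ → p *P q ≈ₚ p *P q′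
  *P-congˡ []      e = ≈ₚ-refl
  *P-congˡ (a ∷ p) e = +P-cong (scale-cong a e) (shift-cong (*P-congˡ p e))

  *P-∷ʳ : ∀ p a q → p *P (a ∷ q) ≈ₚ scale a p +P shift (p *P q)
  *P-∷ʳ []      a q = ≈ₚ-sym shift-[]
  *P-∷ʳ (b ∷ p) a q = ∷-cong (≡⇒≡ₘ (≡.cong (_+ℤ + 0) (ℤ.*-comm b a)))
    (≈ₚ-trans (+P-cong ≈ₚ-refl (*P-∷ʳ p a q)) (x∙yz≈y∙xz (scale b q) (scale a p) (shift (p *P q))))

  *P-comm : ∀ p q → p *P q ≈ₚ q *P p
  *P-comm []      q = ≈ₚ-sym (*P-zeroʳ q)
  *P-comm (a ∷ p) q = ≈ₚ-trans (+P-cong ≈ₚ-refl (shift-cong (*P-comm p q))) (≈ₚ-sym (*P-∷ʳ q a p))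

  *P-cong : ∀ {p p′ q q′} → p ≈ₚ p′ → q ≈ₚ q′ → p *P q ≈ₚ p′ *P q′
  *P-cong {p} {p′} {q} {q′} e f =
    ≈ₚ-trans (*P-congˡ p f) (≈ₚ-trans (*P-comm p q′) (≈ₚ-trans (*P-congˡ q′ e) (*P-comm q′ p′)))

  *P-congʳ : ∀ q {p p′} → p ≈ₚ p′ → p *P q ≈ₚ p′ *P q
  *P-congʳ q e = *P-cong e (≈ₚ-refl {q})

  *P-distribʳ : ∀ r p q → (p +P q) *P r ≈ₚ (p *P r) +P (q *P r)
  *P-distribʳ r []      q       = ≈ₚ-refl
  *P-distribʳ r (a ∷ p) []      = ≈ₚ-sym (+P-identityʳ ((a ∷ p) *P r))
  *P-distribʳ r (a ∷ p) (b ∷ q) = ≈ₚ-trans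
    (+P-cong (scale-distribʳ a b r) (shift-cong (*P-distribʳ r p q)))
    (interchange (scale a r) (scale b r) (shift (p *P r)) (shift (q *P r)))

  scale-*P : ∀ a p r → scale a p *P r ≈ₚ scale a (p *P r)
  scale-*P a []      r = ≈ₚ-refl
  scale-*P a (b ∷ p) r = ≈ₚ-trans
    (+P-cong (scale-scale a b r) (≈ₚ-trans (shift-cong (scale-*P a p r)) (≈ₚ-sym (scale-shift a (p *P r)))))
    (≈ₚ-sym (scale-+P a (scale b r) (shift (p *P r))))

  shift-*P : ∀ p r → shift p *P r ≈ₚ shift (p *P r)
  shift-*P p r = +P-cong (scale-zero r) ≈ₚ-refl

  *P-assoc : ∀ p q r → (p *P q) *P r ≈ₚ p *P (q *P r)
  *P-assoc []      q r = ≈ₚ-refl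
  *P-assoc (a ∷ p) q r = ≈ₚ-trans (*P-distribʳ r (scale a q) (shift (p *P q)))
    (+P-cong (scale-*P a q r) (≈ₚ-trans (shift-*P (p *P q) r) (shift-cong (*P-assoc p q r))))

  *P-identityˡ : ∀ p → (+ 1 ∷ []) *P p ≈ₚ p
  *P-identityˡ p = ≈ₚ-trans (+P-cong (scale-one p) shift-[]) (+P-identityʳ p)

  polynomialRing : CommutativeRing 0ℓ 0ℓ
  polynomialRing = record
    { Carrier = Poly ; _≈_ = _≈ₚ_ ; _+_ = _+P_ ; _*_ = _*P_ ; -_ = -P_ ; 0# = [] ; 1# = + 1 ∷ []
    ; isCommutativeRing = record
      { isRing = record
        { +-isAbelianGroup = record
          { isGroup = record
            { isMonoid = IsCommutativeMonoid.isMonoid +P-isCommutativeMonoid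
            ; inverse = -P-inverseˡ , -P-inverseʳ
            ; ⁻¹-cong = -P-cong }
          ; comm = +P-comm }
        ; *-cong = *P-cong
        ; *-assoc = *P-assoc
        ; *-identity = *P-identityˡ , (λ p → ≈ₚ-trans (*P-comm p _) (*P-identityˡ p))
        ; distrib = (λ r p q → ≈ₚ-trans (*P-comm r (p +P q))
                      (≈ₚ-trans (*P-distribʳ r p q) (+P-cong (*P-comm p r) (*P-comm q r))))
                  , *P-distribʳ }
      ; *-comm = *P-comm } }

  open import Algebra.Properties.Semiring.Exp (CommutativeRing.semiring polynomialRing) using (_^_)
  open import Algebra.Properties.Semiring.Sum (CommutativeRing.semiring polynomialRing) using (sum-syntax)
  open import Algebra.Properties.Semiring.Mult (CommutativeRing.semiring polynomialRing) using (_×_)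

  constℕ : ℕ → Poly
  constℕ n = constP (+ n)

  constℕ-0 : constℕ 0 ≈ₚ []
  constℕ-0 = shift-[]

  constP-cong : ∀ {a b} → a ≡ₘ b → constP a ≈ₚ constP b
  constP-cong e = ∷-cong e ≈ₚ-refl

  constP-*P : ∀ a p → constP a *P p ≈ₚ scale a p
  constP-*P a p = ≈ₚ-trans (+P-cong ≈ₚ-refl shift-[]) (+P-identityʳ (scale a p))

  constP-* : ∀ a b → constP a *P constP b ≈ₚ constP (a *ℤ b)
  constP-* a b = constP-*P a (constP b)

  constℕ-* : ∀ a b → constℕ a *P constℕ b ≈ₚ constℕ (a ℕ.* b)
  constℕ-* a b = ≈ₚ-trans (constP-* (+ a) (+ b)) (constP-cong (≡⇒≡ₘ (≡.sym (ℤ.pos-* a b))))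

  constℕ-^ : ∀ a n → constℕ (a ℕ.^ n) ≈ₚ constℕ a ^ n
  constℕ-^ a zero    = ≈ₚ-refl
  constℕ-^ a (suc n) = ≈ₚ-trans (≈ₚ-sym (constℕ-* a (a ℕ.^ n))) (*P-congˡ (constℕ a) (constℕ-^ a n))

  ×-≈-constℕ-*P : ∀ n p → n × p ≈ₚ constℕ n *P p
  ×-≈-constℕ-*P zero    p = ≈ₚ-sym (≈ₚ-trans (constP-*P (+ 0) p) (scale-zero p))
  ×-≈-constℕ-*P (suc n) p = ≈ₚ-trans
    (+P-cong (≈ₚ-sym (scale-one p)) (≈ₚ-trans (×-≈-constℕ-*P n p) (constP-*P (+ n) p)))
    (≈ₚ-trans (≈ₚ-sym (scale-distribʳ (+ 1) (+ n) p)) (≈ₚ-sym (constP-*P (+ suc n) p)))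

  X-*P : ∀ p → X *P p ≈ₚ shift p
  X-*P p = +P-cong (scale-zero p) (shift-cong (*P-identityˡ p))

  X^suc-*P : ∀ d p → (X ^ suc d) *P p ≈ₚ shift ((X ^ d) *P p)
  X^suc-*P d p = ≈ₚ-trans (*P-assoc X (X ^ d) p) (X-*P ((X ^ d) *P p))

  coeff-X^-*P : ∀ d e p → coeff ((X ^ d) *P p) (d ℕ.+ e) ≡ₘ coeff p e
  coeff-X^-*P zero    e p = coeff-≡ₘ (*P-identityˡ p) e
  coeff-X^-*P (suc d) e p = ≡ₘ-trans (coeff-≡ₘ (X^suc-*P d p) (suc (d ℕ.+ e))) (coeff-X^-*P d e p)

  coeff-X^-*P-< : ∀ d j p → j ℕ.< d → coeff ((X ^ d) *P p) j ≡ₘ + 0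
  coeff-X^-*P-< (suc d) zero    p j<d       = coeff-≡ₘ (X^suc-*P d p) zero
  coeff-X^-*P-< (suc d) (suc j) p (s≤s j<d) = ≡ₘ-trans (coeff-≡ₘ (X^suc-*P d p) (suc j)) (coeff-X^-*P-< d j p j<d)

  X+c-*P : ∀ c q → (X +P constℕ c) *P q ≈ₚ scale (+ c) q +P shift q
  X+c-*P c q = +P-cong ≈ₚ-refl (shift-cong (*P-identityˡ q))

  coeff-X+c^ : ∀ c k j → coeff ((X +P constℕ c) ^ k) j ≡ₘ + scaledBinomial c k j
  coeff-X+c^ c zero    zero    = ≡ₘ-refl
  coeff-X+c^ c zero    (suc j) = ≡ₘ-refl
  coeff-X+c^ c (suc k) j = begin
    coeff ((X +P constℕ c) *P Q) j                 ≈⟨ coeff-≡ₘ (X+c-*P c Q) j ⟩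
    coeff (scale (+ c) Q +P shift Q) j             ≡⟨ coeff-+P (scale (+ c) Q) (shift Q) j ⟩
    coeff (scale (+ c) Q) j +ℤ coeff (shift Q) j   ≡⟨ ≡.cong (_+ℤ coeff (shift Q) j) (coeff-scale (+ c) Q j) ⟩
    + c *ℤ coeff Q j +ℤ coeff (shift Q) j          ≈⟨ pascal j ⟩
    + scaledBinomial c (suc k) j                   ∎
    where
    open ≡ₘ-Reasoning
    Q = (X +P constℕ c) ^ k
    pascal : ∀ j → + c *ℤ coeff Q j +ℤ coeff (shift Q) j ≡ₘ + scaledBinomial c (suc k) j
    pascal zero = begin
      + c *ℤ coeff Q zero +ℤ + 0
        ≈⟨ +-cong-≡ₘ (*-cong-≡ₘ (≡ₘ-refl {+ c}) (coeff-X+c^ c k zero)) ≡ₘ-refl ⟩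
      + c *ℤ + scaledBinomial c k zero +ℤ + 0 ≡⟨ ℤ.+-identityʳ _ ⟩
      + c *ℤ + scaledBinomial c k zero        ≡⟨ ℤ.pos-* c _ ⟨
      + (c ℕ.* scaledBinomial c k zero)       ≡⟨ ≡.cong +_ (scaledBinomial-zero c k) ⟩
      + scaledBinomial c (suc k) zero         ∎
    pascal (suc j) = begin
      + c *ℤ coeff Q (suc j) +ℤ coeff Q j
        ≈⟨ +-cong-≡ₘ (*-cong-≡ₘ (≡ₘ-refl {+ c}) (coeff-X+c^ c k (suc j))) (coeff-X+c^ c k j) ⟩
      + c *ℤ + scaledBinomial c k (suc j) +ℤ + scaledBinomial c k j
        ≡⟨ ≡.cong (_+ℤ + scaledBinomial c k j) (ℤ.pos-* c _) ⟨
      + (c ℕ.* scaledBinomial c k (suc j) ℕ.+ scaledBinomial c k j)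
        ≡⟨ ≡.cong +_ (scaledBinomial-pascal c k j) ⟩
      + scaledBinomial c (suc k) (suc j) ∎

  coeff-X^-*P-[X+1]^ : ∀ d k j → j ℕ.≤ d ℕ.+ k →
    coeff ((X ^ d) *P ((X +P constℕ 1) ^ k)) j ≡ₘ + (k C ((d ℕ.+ k) ∸ j))
  coeff-X^-*P-[X+1]^ d k j j≤d+k with j ℕ.<? d
  ... | yes j<d = ≡ₘ-trans (coeff-X^-*P-< d j _ j<d) (≡⇒≡ₘ (≡.cong +_ (≡.sym (k>n⇒nCk≡0 k<d+k∸j))))
    where
    k<d+k∸j : k ℕ.< (d ℕ.+ k) ∸ j
    k<d+k∸j = ≡.subst (k ℕ.<_) (≡.sym (ℕ.+-∸-comm k (ℕ.<⇒≤ j<d))) (ℕ.m<n+m k (ℕ.m<n⇒0<n∸m j<d))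
  ... | no j≮d = begin
    coeff q j                        ≡⟨ ≡.cong (coeff q) d+e≡j ⟨
    coeff q (d ℕ.+ e)                ≈⟨ coeff-X^-*P d e _ ⟩
    coeff ((X +P constℕ 1) ^ k) e    ≈⟨ coeff-X+c^ 1 k e ⟩
    + ((k C e) ℕ.* 1 ℕ.^ (k ∸ e))    ≡⟨ ≡.cong (λ n → + ((k C e) ℕ.* n)) (ℕ.^-zeroˡ (k ∸ e)) ⟩
    + ((k C e) ℕ.* 1)                ≡⟨ ≡.cong +_ (ℕ.*-identityʳ (k C e)) ⟩
    + (k C e)                        ≡⟨ ≡.cong +_ (nCk≡nC[n∸k] e≤k) ⟩
    + (k C (k ∸ e))                  ≡⟨ ≡.cong (λ n → + (k C n)) (ℕ.[m+n]∸[m+o]≡n∸o d k e) ⟨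
    + (k C ((d ℕ.+ k) ∸ (d ℕ.+ e)))  ≡⟨ ≡.cong (λ n → + (k C ((d ℕ.+ k) ∸ n))) d+e≡j ⟩
    + (k C ((d ℕ.+ k) ∸ j))          ∎
    where
    open ≡ₘ-Reasoning
    q : Poly
    q = (X ^ d) *P ((X +P constℕ 1) ^ k)
    e = j ∸ d
    d+e≡j : d ℕ.+ e ≡ j
    d+e≡j = ℕ.m+[n∸m]≡n (ℕ.≮⇒≥ j≮d)
    e≤k : e ℕ.≤ k
    e≤k = ℕ.+-cancelˡ-≤ d e k (≡.subst (ℕ._≤ d ℕ.+ k) (≡.sym d+e≡j) j≤d+k)

  -- The j-th coefficient as a constant polynomial, so that matrix entries and row polynomials
  -- live in the same ring.
  coeffP : ℕ → Poly → Poly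
  coeffP j p = constP (coeff p j)

  coeffP-cong : ∀ j {p q} → p ≈ₚ q → coeffP j p ≈ₚ coeffP j q
  coeffP-cong j e = constP-cong (coeff-≡ₘ e j)

  coeffP-constP-*P : ∀ j a p → coeffP j (constP a *P p) ≈ₚ constP a *P coeffP j p
  coeffP-constP-*P j a p = ≈ₚ-trans
    (constP-cong (≡ₘ-trans (coeff-≡ₘ (constP-*P a p) j) (≡⇒≡ₘ (coeff-scale a p j))))
    (≈ₚ-sym (constP-* a (coeff p j)))

  coeffP-linear : ∀ {n} j (a : Fin n → ℤ) (f : Fin n → Poly) →
    coeffP j (∑[ k < n ] (constP (a k) *P f k)) ≈ₚ ∑[ k < n ] (constP (a k) *P coeffP j (f k))
  coeffP-linear {zero}  j a f = shift-[]
  coeffP-linear {suc n} j a f = ≈ₚ-trans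
    (constP-cong (≡⇒≡ₘ (coeff-+P (constP (a zero) *P f zero) (∑[ k < n ] (constP (a (suc k)) *P f (suc k))) j)))
    (+P-cong (coeffP-constP-*P j (a zero) (f zero)) (coeffP-linear j (a ∘ suc) (f ∘ suc)))

open PolynomialsModulo (+ 5)

3^[4k+r]≡ₘ3^r : ∀ k r → + (3 ℕ.^ (4 ℕ.* k ℕ.+ r)) ≡ₘ + (3 ℕ.^ r)
3^[4k+r]≡ₘ3^r zero    r = ≡ₘ-refl
3^[4k+r]≡ₘ3^r (suc k) r = begin
  + (3 ℕ.^ (4 ℕ.* suc k ℕ.+ r))  ≡⟨ ≡.cong (λ e → + (3 ℕ.^ e)) (4*[1+k]+r≡4+[4*k+r] k r) ⟩
  + (3 ℕ.^ (4 ℕ.+ n))            ≡⟨ ≡.cong +_ (3⁴* (3 ℕ.^ n)) ⟩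
  + (81 ℕ.* 3 ℕ.^ n)             ≡⟨ ℤ.pos-* 81 (3 ℕ.^ n) ⟩
  + 81 *ℤ + (3 ℕ.^ n)            ≈⟨ *-cong-≡ₘ 81≡ₘ1 ≡ₘ-refl ⟩
  + 1 *ℤ + (3 ℕ.^ n)             ≡⟨ ℤ.*-identityˡ (+ (3 ℕ.^ n)) ⟩
  + (3 ℕ.^ n)                    ≈⟨ 3^[4k+r]≡ₘ3^r k r ⟩
  + (3 ℕ.^ r)                    ∎
  where
  open ≡ₘ-Reasoning
  n = 4 ℕ.* k ℕ.+ r
  4*[1+k]+r≡4+[4*k+r] : ∀ k r → 4 ℕ.* suc k ℕ.+ r ≡ 4 ℕ.+ (4 ℕ.* k ℕ.+ r)
  4*[1+k]+r≡4+[4*k+r] = solve-∀ℕ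
  3⁴* : ∀ x → 3 ℕ.* (3 ℕ.* (3 ℕ.* (3 ℕ.* x))) ≡ 81 ℕ.* x
  3⁴* = solve-∀ℕ
  81≡ₘ1 : + 81 ≡ₘ + 1
  81≡ₘ1 = ≡ₘ-intro (divides (+ 16) ≡.refl)

module CharacteristicPolynomialModFive where

  open Summation polynomialRing using (∑-truncate)
  open Determinant polynomialRing
  open CommutativeRing polynomialRing
    using (_+_; _*_; _-_; 0#; 1#; reflexive; *-comm; *-cong; *-assoc; *-identityˡ; *-identityʳ; zeroˡ; zeroʳ)
  open import Algebra.Properties.Ring (CommutativeRing.ring polynomialRing) using (+-inverseʳ-unique)
  open import Algebra.Properties.Semiring.Exp (CommutativeRing.semiring polynomialRing)
    using (_^_; ^-congˡ; ^-homo-*)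
  open import Algebra.Properties.CommutativeSemiring.Exp (CommutativeRing.commutativeSemiring polynomialRing)
    using (^-distrib-*)
  open import Algebra.Properties.Semiring.Mult (CommutativeRing.semiring polynomialRing) using (_×_)
  open import Algebra.Properties.Semiring.Sum (CommutativeRing.semiring polynomialRing)
    using (sum-syntax; sum⁺-syntax; sum-cong-≋; sum-cong-≗; *-distribˡ-sum)
  open import Algebra.Properties.CommutativeSemiring.Binomial (CommutativeRing.commutativeSemiring polynomialRing)
    using () renaming (theorem to binomialTheorem)
  open SetoidReasoning (CommutativeRing.setoid polynomialRing)

  private
    polynomialSolverRing : ACR.AlmostCommutativeRing 0ℓ 0ℓ
    polynomialSolverRing = ACR.fromCommutativeRing polynomialRing (λ _ → nothing)

  open NonReflective polynomialSolverRing using (solve; _⊜_; _⊕_; _⊗_; ⊝_)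

  sumP≡∑ : ∀ n (f : Fin n → Poly) → sumP n f ≡ ∑[ i < n ] f i
  sumP≡∑ zero    f = ≡.refl
  sumP≡∑ (suc n) f = ≡.cong (f zero +P_) (sumP≡∑ n (f ∘ suc))

  signP≡signed : ∀ k p → signP k p ≡ signed k p
  signP≡signed zero    p = ≡.refl
  signP≡signed (suc k) p = ≡.cong -P_ (signP≡signed k p)

  Defs-det≡det : ∀ n M → Defs.det n M ≡ det n M
  Defs-det≡det zero    M = ≡.refl
  Defs-det≡det (suc n) M = ≡.trans (sumP≡∑ (suc n) term) (sum-cong-≗ λ j →
    ≡.trans (signP≡signed (toℕ j) _)
            (≡.cong (λ d → signed (toℕ j) (M zero j *P d)) (Defs-det≡det n (minor M j))))
    where
    term : Fin (suc n) → Poly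
    term j = signP (toℕ j) (M zero j *P Defs.det n (minor M j))

  ^P≡^ : ∀ p n → p ^P n ≡ p ^ n
  ^P≡^ p zero    = ≡.refl
  ^P≡^ p (suc n) = ≡.cong (p *P_) (^P≡^ p n)

  constMatrix : ∀ {n} → (Fin n → Fin n → ℤ) → Matrix n
  constMatrix A i j = constP (A i j)

  charMatrix≈ : ∀ n → charMatrix n ≈ᴹ constMatrix (Defs.R n) -ᵈ X
  charMatrix≈ n i j with i ≟ j
  ... | yes ≡.refl = +P-cong ≈ₚ-refl (-P-cong (≈ₚ-sym X*δᵢᵢ≈X))
    where
    X*δᵢᵢ≈X : X * δ i i ≈ₚ X
    X*δᵢᵢ≈X = ≈ₚ-trans (*P-congˡ X (reflexive (δ-refl i))) (*-identityʳ X)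
  ... | no i≢j = ≈ₚ-sym (≈ₚ-trans (+P-cong ≈ₚ-refl (-P-cong X*δᵢⱼ≈0)) (+P-identityʳ (constP (Defs.R n i j))))
    where
    X*δᵢⱼ≈0 : X * δ i j ≈ₚ 0#
    X*δᵢⱼ≈0 = ≈ₚ-trans (*P-congˡ X (reflexive (δ-≢ i≢j))) (zeroʳ X)

  -- T N i k is the coefficient of yᵏ in (3y)ⁱ (y + 3)^(N ∸ i).
  T : ℕ → ℕ → ℕ → ℕ
  T N zero    k       = 3 ℕ.^ (N ∸ k) ℕ.* (N C k)
  T N (suc i) zero    = 0
  T N (suc i) (suc k) = 3 ℕ.* T (ℕ.pred N) i k

  T-lower : ∀ N i k → k ℕ.< i → T N i k ≡ 0
  T-lower N (suc i) zero    _         = ≡.refl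
  T-lower N (suc i) (suc k) (s≤s k<i) = ≡.cong (3 ℕ.*_) (T-lower (ℕ.pred N) i k k<i)

  T-diagonal : ∀ N i → i ℕ.≤ N → T N i i ≡ 3 ℕ.^ N
  T-diagonal N       zero    _         = ℕ.*-identityʳ (3 ℕ.^ N)
  T-diagonal (suc N) (suc i) (s≤s i≤N) = ≡.cong (3 ℕ.*_) (T-diagonal N i i≤N)

  Rᴹ Pᴹ Tᴹ : ∀ N → Matrix (suc N)
  Rᴹ N = constMatrix (Defs.R (suc N))
  Pᴹ N i k = constℕ (scaledBinomial 2 (toℕ i) (toℕ k))
  Tᴹ N i k = constℕ (T N (toℕ i) (toℕ k))

  Pᴹ-lowerUnitriangular : ∀ N → LowerUnitriangular (Pᴹ N)
  Pᴹ-lowerUnitriangular N = record { diagonal = diagonal ; upper = upper }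
    where
    diagonal : ∀ i → Pᴹ N i i ≈ₚ 1#
    diagonal i = reflexive (≡.cong constℕ
      (≡.cong₂ ℕ._*_ (nCn≡1 (toℕ i)) (≡.cong (2 ℕ.^_) (ℕ.n∸n≡0 (toℕ i)))))
    upper : ∀ i k → i Fin.< k → Pᴹ N i k ≈ₚ 0#
    upper i k i<k = ≈ₚ-trans
      (reflexive (≡.cong (λ c → constℕ (c ℕ.* 2 ℕ.^ (toℕ i ∸ toℕ k))) (k>n⇒nCk≡0 i<k))) constℕ-0

  Tᴹ-upperTriangular : ∀ N → UpperTriangular (Tᴹ N)
  Tᴹ-upperTriangular N i k k<i =
    ≈ₚ-trans (reflexive (≡.cong constℕ (T-lower N (toℕ i) (toℕ k) k<i))) constℕ-0

  Tᴹ-diagonal : ∀ N i → Tᴹ N i i ≈ₚ constℕ (3 ℕ.^ N)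
  Tᴹ-diagonal N i = reflexive (≡.cong constℕ (T-diagonal N (toℕ i) (ℕ.≤-pred (toℕ<n i))))

  -- Read as ∑ⱼ Rₖⱼ xʲ, the k-th row of R_(N+1) is this polynomial.
  rowOfR : ℕ → ℕ → Poly
  rowOfR N k = X ^ (N ∸ k) * (X + constℕ 1) ^ k

  coeff-rowOfR : ∀ N k j → k ℕ.≤ N → j ℕ.≤ N → coeff (rowOfR N k) j ≡ₘ + (k C (N ∸ j))
  coeff-rowOfR N k j k≤N j≤N = ≡.subst (λ n → coeff (rowOfR N k) j ≡ₘ + (k C (n ∸ j))) N∸k+k≡N
    (coeff-X^-*P-[X+1]^ (N ∸ k) k j (≡.subst (j ℕ.≤_) (≡.sym N∸k+k≡N) j≤N))
    where
    N∸k+k≡N : (N ∸ k) ℕ.+ k ≡ N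
    N∸k+k≡N = ℕ.m∸n+n≡m k≤N

  ∑-Pᴹ-rowsOfR : ∀ N i → i ℕ.≤ N →
    ∑[ k ≤ N ] (constℕ (scaledBinomial 2 i (toℕ k)) * rowOfR N (toℕ k))
      ≈ₚ X ^ (N ∸ i) * (X + constℕ 1 + constℕ 2 * X) ^ i
  ∑-Pᴹ-rowsOfR N i i≤N = begin
    ∑[ k ≤ N ] (constℕ (scaledBinomial 2 i (toℕ k)) * rowOfR N (toℕ k))
      ≈⟨ sum-cong-≋ {suc N} (λ k → term (toℕ k)) ⟩
    ∑[ k ≤ N ] (X ^ (N ∸ i) * binomialTerm (toℕ k))
      ≈⟨ *-distribˡ-sum {suc N} (X ^ (N ∸ i)) (λ k → binomialTerm (toℕ k)) ⟨
    X ^ (N ∸ i) * ∑[ k ≤ N ] binomialTerm (toℕ k)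
      ≈⟨ *P-congˡ (X ^ (N ∸ i)) (∑-truncate i≤N binomialTerm vanish) ⟩
    X ^ (N ∸ i) * ∑[ k ≤ i ] binomialTerm (toℕ k)
      ≈⟨ *P-congˡ (X ^ (N ∸ i)) (binomialTheorem i a b) ⟨
    X ^ (N ∸ i) * (a + b) ^ i ∎
    where
    a b : Poly
    a = X + constℕ 1
    b = constℕ 2 * X
    binomialTerm : ℕ → Poly
    binomialTerm l = (i C l) × (a ^ l * b ^ (i ∸ l))
    vanish : ∀ l → i ℕ.< l → binomialTerm l ≈ₚ 0#
    vanish l i<l = reflexive (≡.cong (_× (a ^ l * b ^ (i ∸ l))) (k>n⇒nCk≡0 i<l))
    term : ∀ l → constℕ (scaledBinomial 2 i l) * rowOfR N l ≈ₚ X ^ (N ∸ i) * binomialTerm l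
    term l with l ℕ.≤? i
    ... | yes l≤i = begin
      constℕ (c ℕ.* 2 ℕ.^ (i ∸ l)) * (X ^ (N ∸ l) * a ^ l)
        ≈⟨ *-cong const≈ (*P-congʳ (a ^ l) X^[N∸l]≈X^[N∸i]*X^[i∸l]) ⟩
      (constℕ c * constℕ 2 ^ (i ∸ l)) * ((X ^ (N ∸ i) * X ^ (i ∸ l)) * a ^ l)
        ≈⟨ solve 5 (λ c t x y A → ((c ⊗ t) ⊗ ((x ⊗ y) ⊗ A)) ⊜ (x ⊗ (c ⊗ (A ⊗ (t ⊗ y))))) ≈ₚ-refl
                 (constℕ c) (constℕ 2 ^ (i ∸ l)) (X ^ (N ∸ i)) (X ^ (i ∸ l)) (a ^ l) ⟩
      X ^ (N ∸ i) * (constℕ c * (a ^ l * (constℕ 2 ^ (i ∸ l) * X ^ (i ∸ l))))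
        ≈⟨ *P-congˡ (X ^ (N ∸ i)) (*P-congˡ (constℕ c) (*P-congˡ (a ^ l) (^-distrib-* (constℕ 2) X (i ∸ l)))) ⟨
      X ^ (N ∸ i) * (constℕ c * (a ^ l * b ^ (i ∸ l)))
        ≈⟨ *P-congˡ (X ^ (N ∸ i)) (×-≈-constℕ-*P c (a ^ l * b ^ (i ∸ l))) ⟨
      X ^ (N ∸ i) * binomialTerm l ∎
      where
      c = i C l
      const≈ : constℕ (c ℕ.* 2 ℕ.^ (i ∸ l)) ≈ₚ constℕ c * constℕ 2 ^ (i ∸ l)
      const≈ = ≈ₚ-trans (≈ₚ-sym (constℕ-* c (2 ℕ.^ (i ∸ l)))) (*P-congˡ (constℕ c) (constℕ-^ 2 (i ∸ l)))
      N∸l≡N∸i+i∸l : N ∸ l ≡ (N ∸ i) ℕ.+ (i ∸ l)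
      N∸l≡N∸i+i∸l = ≡.trans (≡.cong (_∸ l) (≡.sym (ℕ.m∸n+n≡m i≤N))) (ℕ.+-∸-assoc (N ∸ i) l≤i)
      X^[N∸l]≈X^[N∸i]*X^[i∸l] : X ^ (N ∸ l) ≈ₚ X ^ (N ∸ i) * X ^ (i ∸ l)
      X^[N∸l]≈X^[N∸i]*X^[i∸l] = ≈ₚ-trans (reflexive (≡.cong (X ^_) N∸l≡N∸i+i∸l)) (^-homo-* X (N ∸ i) (i ∸ l))
    ... | no l≰i =
      ≈ₚ-trans lhs≈0 (≈ₚ-sym (≈ₚ-trans (*P-congˡ (X ^ (N ∸ i)) (vanish l i<l)) (zeroʳ (X ^ (N ∸ i)))))
      where
      i<l : i ℕ.< l
      i<l = ℕ.≰⇒> l≰i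
      lhs≈0 : constℕ (scaledBinomial 2 i l) * rowOfR N l ≈ₚ 0#
      lhs≈0 = ≈ₚ-trans (*P-congʳ (rowOfR N l) (≈ₚ-trans
                (reflexive (≡.cong (λ c → constℕ (c ℕ.* 2 ℕ.^ (i ∸ l))) (k>n⇒nCk≡0 i<l))) constℕ-0))
              (zeroˡ (rowOfR N l))

  ∑-Tᴹ-powers : ∀ N i → i ℕ.≤ N →
    ∑[ k ≤ N ] (constℕ (T N i (toℕ k)) * (X + constℕ 2) ^ toℕ k)
      ≈ₚ (constℕ 3 * (X + constℕ 2)) ^ i * (X + constℕ 2 + constℕ 3) ^ (N ∸ i)
  ∑-Tᴹ-powers N zero z≤n = begin
    ∑[ k ≤ N ] (constℕ (3 ℕ.^ (N ∸ toℕ k) ℕ.* (N C toℕ k)) * y ^ toℕ k)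
      ≈⟨ sum-cong-≋ {suc N} (λ k → term (toℕ k)) ⟩
    ∑[ k ≤ N ] ((N C toℕ k) × (y ^ toℕ k * constℕ 3 ^ (N ∸ toℕ k)))
      ≈⟨ binomialTheorem N y (constℕ 3) ⟨
    (y + constℕ 3) ^ N
      ≈⟨ *-identityˡ _ ⟨
    1# * (y + constℕ 3) ^ N ∎
    where
    y : Poly
    y = X + constℕ 2
    term : ∀ l → constℕ (3 ℕ.^ (N ∸ l) ℕ.* (N C l)) * y ^ l ≈ₚ (N C l) × (y ^ l * constℕ 3 ^ (N ∸ l))
    term l = begin
      constℕ (3 ℕ.^ (N ∸ l) ℕ.* c) * y ^ l
        ≈⟨ *P-congʳ (y ^ l) (≈ₚ-trans (≈ₚ-sym (constℕ-* (3 ℕ.^ (N ∸ l)) c))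
                                      (*P-congʳ (constℕ c) (constℕ-^ 3 (N ∸ l)))) ⟩
      (constℕ 3 ^ (N ∸ l) * constℕ c) * y ^ l
        ≈⟨ solve 3 (λ t c z → ((t ⊗ c) ⊗ z) ⊜ (c ⊗ (z ⊗ t))) ≈ₚ-refl (constℕ 3 ^ (N ∸ l)) (constℕ c) _ ⟩
      constℕ c * (y ^ l * constℕ 3 ^ (N ∸ l))
        ≈⟨ ×-≈-constℕ-*P c (y ^ l * constℕ 3 ^ (N ∸ l)) ⟨
      c × (y ^ l * constℕ 3 ^ (N ∸ l)) ∎
      where
      c = N C l
  ∑-Tᴹ-powers (suc N) (suc i) (s≤s i≤N) = begin
    constℕ 0 * 1# + ∑[ k ≤ N ] (constℕ (3 ℕ.* T N i (toℕ k)) * (y * y ^ toℕ k))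
      ≈⟨ +P-cong (≈ₚ-trans (*P-congʳ 1# constℕ-0) (zeroˡ 1#))
                 (sum-cong-≋ {suc N} (λ k → step (T N i (toℕ k)) (y ^ toℕ k))) ⟩
    0# + ∑[ k ≤ N ] ((constℕ 3 * y) * (constℕ (T N i (toℕ k)) * y ^ toℕ k))
      ≈⟨ *-distribˡ-sum {suc N} (constℕ 3 * y) (λ k → constℕ (T N i (toℕ k)) * y ^ toℕ k) ⟨
    (constℕ 3 * y) * ∑[ k ≤ N ] (constℕ (T N i (toℕ k)) * y ^ toℕ k)
      ≈⟨ *P-congˡ (constℕ 3 * y) (∑-Tᴹ-powers N i i≤N) ⟩
    (constℕ 3 * y) * ((constℕ 3 * y) ^ i * (y + constℕ 3) ^ (N ∸ i))
      ≈⟨ *-assoc (constℕ 3 * y) ((constℕ 3 * y) ^ i) ((y + constℕ 3) ^ (N ∸ i)) ⟨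
    (constℕ 3 * y) ^ suc i * (y + constℕ 3) ^ (suc N ∸ suc i) ∎
    where
    y : Poly
    y = X + constℕ 2
    step : ∀ t z → constℕ (3 ℕ.* t) * (y * z) ≈ₚ (constℕ 3 * y) * (constℕ t * z)
    step t z = ≈ₚ-trans (*P-congʳ (y * z) (≈ₚ-sym (constℕ-* 3 t)))
      (solve 4 (λ h t y z → ((h ⊗ t) ⊗ (y ⊗ z)) ⊜ ((h ⊗ y) ⊗ (t ⊗ z))) ≈ₚ-refl (constℕ 3) (constℕ t) y z)

  -- These two congruences are where the modulus 5 enters the similarity Pᴹ * Rᴹ ≈ Tᴹ * Pᴹ.
  X+1+2X≈3[X+2] : X + constℕ 1 + constℕ 2 * X ≈ₚ constℕ 3 * (X + constℕ 2)
  X+1+2X≈3[X+2] = coeffwise λ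
    { zero → ≡ₘ-intro (divides (ℤ.- + 1) ≡.refl) ; (suc zero) → ≡ₘ-refl ; (suc (suc k)) → ≡ₘ-refl }

  X+2+3≈X : X + constℕ 2 + constℕ 3 ≈ₚ X
  X+2+3≈X = coeffwise λ
    { zero → ≡ₘ-intro (divides (+ 1) ≡.refl) ; (suc zero) → ≡ₘ-refl ; (suc (suc k)) → ≡ₘ-refl }

  rowsOfPR≈rowsOfTP : ∀ N i → i ℕ.≤ N →
    ∑[ k ≤ N ] (constℕ (scaledBinomial 2 i (toℕ k)) * rowOfR N (toℕ k))
      ≈ₚ ∑[ k ≤ N ] (constℕ (T N i (toℕ k)) * (X + constℕ 2) ^ toℕ k)
  rowsOfPR≈rowsOfTP N i i≤N = begin
    ∑[ k ≤ N ] (constℕ (scaledBinomial 2 i (toℕ k)) * rowOfR N (toℕ k))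
      ≈⟨ ∑-Pᴹ-rowsOfR N i i≤N ⟩
    X ^ (N ∸ i) * (X + constℕ 1 + constℕ 2 * X) ^ i
      ≈⟨ *-comm (X ^ (N ∸ i)) _ ⟩
    (X + constℕ 1 + constℕ 2 * X) ^ i * X ^ (N ∸ i)
      ≈⟨ *-cong (^-congˡ i X+1+2X≈3[X+2]) (^-congˡ (N ∸ i) (≈ₚ-sym X+2+3≈X)) ⟩
    (constℕ 3 * (X + constℕ 2)) ^ i * (X + constℕ 2 + constℕ 3) ^ (N ∸ i)
      ≈⟨ ∑-Tᴹ-powers N i i≤N ⟨
    ∑[ k ≤ N ] (constℕ (T N i (toℕ k)) * (X + constℕ 2) ^ toℕ k) ∎

  Pᴹ*Rᴹ≈Tᴹ*Pᴹ : ∀ N → Pᴹ N *ᴹ Rᴹ N ≈ᴹ Tᴹ N *ᴹ Pᴹ N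
  Pᴹ*Rᴹ≈Tᴹ*Pᴹ N i j = begin
    ∑[ k ≤ N ] (Pᴹ N i k * Rᴹ N k j)
      ≈⟨ sum-cong-≋ {suc N} (λ k →
           *P-congˡ (Pᴹ N i k) (constP-cong (≡ₘ-sym (coeff-rowOfR N _ _ (≤N k) (≤N j))))) ⟩
    ∑[ k ≤ N ] (Pᴹ N i k * coeffP (toℕ j) (rowOfR N (toℕ k)))
      ≈⟨ coeffP-linear {suc N} (toℕ j) (λ k → + scaledBinomial 2 (toℕ i) (toℕ k)) (rowOfR N ∘ toℕ) ⟨
    coeffP (toℕ j) (∑[ k ≤ N ] (Pᴹ N i k * rowOfR N (toℕ k)))
      ≈⟨ coeffP-cong (toℕ j) (rowsOfPR≈rowsOfTP N (toℕ i) (≤N i)) ⟩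
    coeffP (toℕ j) (∑[ k ≤ N ] (Tᴹ N i k * (X + constℕ 2) ^ toℕ k))
      ≈⟨ coeffP-linear {suc N} (toℕ j) (λ k → + T N (toℕ i) (toℕ k)) (λ k → (X + constℕ 2) ^ toℕ k) ⟩
    ∑[ k ≤ N ] (Tᴹ N i k * coeffP (toℕ j) ((X + constℕ 2) ^ toℕ k))
      ≈⟨ sum-cong-≋ {suc N} (λ k → *P-congˡ (Tᴹ N i k) (constP-cong (coeff-X+c^ 2 (toℕ k) (toℕ j)))) ⟩
    ∑[ k ≤ N ] (Tᴹ N i k * Pᴹ N k j) ∎
    where
    ≤N : (k : Fin (suc N)) → toℕ k ℕ.≤ N
    ≤N k = ℕ.≤-pred (toℕ<n k)

  charPoly≈ : ∀ N → charPoly (suc N) ≈ₚ (constℕ (3 ℕ.^ N) - X) ^ suc N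
  charPoly≈ N = begin
    charPoly (suc N)
      ≡⟨ Defs-det≡det (suc N) (charMatrix (suc N)) ⟩
    det (suc N) (charMatrix (suc N))
      ≈⟨ det-cong (suc N) (charMatrix≈ (suc N)) ⟩
    det (suc N) (Rᴹ N -ᵈ X)
      ≈⟨ det-similar-ᵈ (suc N) (Pᴹ N) (Rᴹ N) (Tᴹ N) (Pᴹ-lowerUnitriangular N) (Pᴹ*Rᴹ≈Tᴹ*Pᴹ N) X ⟩
    det (suc N) (Tᴹ N -ᵈ X)
      ≈⟨ det-upperTriangular-ᵈ (suc N) (Tᴹ N) (constℕ (3 ℕ.^ N)) (Tᴹ-upperTriangular N) (Tᴹ-diagonal N) X ⟩
    (constℕ (3 ℕ.^ N) - X) ^ suc N ∎

  charPoly-4k+r : ∀ k r t → + (3 ℕ.^ r) +ℤ t ≡ₘ + 0 →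
    charPoly (4 ℕ.* k ℕ.+ suc r) ≈ₚ signed (suc r) ((X + constP t) ^P (4 ℕ.* k ℕ.+ suc r))
  charPoly-4k+r k r t 3^r+t≡0 = begin
    charPoly n                                  ≡⟨ ≡.cong charPoly n≡1+N ⟩
    charPoly (suc N)                            ≈⟨ charPoly≈ N ⟩
    (constℕ (3 ℕ.^ N) - X) ^ suc N              ≈⟨ ^-congˡ (suc N) root ⟩
    (-P y) ^ suc N                              ≈⟨ neg-^ (suc N) y ⟩
    signed (suc N) (y ^ suc N)                  ≡⟨ ≡.cong (λ e → signed e (y ^ e)) n≡1+N ⟨
    signed n (y ^ n)                            ≡⟨ ≡.cong (λ e → signed (e ℕ.+ suc r) (y ^ n)) (ℕ.*-assoc 2 2 k) ⟩
    signed (2 ℕ.* (2 ℕ.* k) ℕ.+ suc r) (y ^ n)  ≈⟨ signed-2*+ (2 ℕ.* k) (suc r) (y ^ n) ⟩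
    signed (suc r) (y ^ n)                      ≡⟨ ≡.cong (signed (suc r)) (^P≡^ y n) ⟨
    signed (suc r) (y ^P n)                     ∎
    where
    n N : ℕ
    n = 4 ℕ.* k ℕ.+ suc r
    N = 4 ℕ.* k ℕ.+ r
    n≡1+N : n ≡ suc N
    n≡1+N = ℕ.+-suc (4 ℕ.* k) r
    y : Poly
    y = X + constP t
    c : Poly
    c = constℕ (3 ℕ.^ N)
    c+t≈0 : c + constP t ≈ₚ 0#
    c+t≈0 = ≈ₚ-trans (constP-cong (≡ₘ-trans (+-cong-≡ₘ (3^[4k+r]≡ₘ3^r k r) (≡ₘ-refl {t})) 3^r+t≡0))
                     constℕ-0
    root : c - X ≈ₚ -P y
    root = begin
      c - X         ≈⟨ solve 2 (λ c x → (c ⊕ ⊝ x) ⊜ (⊝ (x ⊕ ⊝ c))) ≈ₚ-refl c X ⟩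
      -P (X - c)    ≈⟨ -P-cong (+P-cong (≈ₚ-refl {X}) (+-inverseʳ-unique c (constP t) c+t≈0)) ⟨
      -P y          ∎

open CharacteristicPolynomialModFive using (charPoly-4k+r)
open import Algebra.Properties.Ring (CommutativeRing.ring polynomialRing) using (-‿involutive)

≈ₚ⇒≡[mod5] : ∀ {p q} → p ≈ₚ q → p ≡[mod5] q
≈ₚ⇒≡[mod5] e k = ∣⇒∣ᵤ (_≡ₘ_.divides-difference (coeff-≡ₘ e k))

open import Data.Nat using (ℕ; _*_; _+_; _≤_)
open import Data.Integer using (+_; -_)
open import Data.Product using (_×_)

mainTheorem3 : (k : ℕ) →
    (1 ≤ 4 * k → charPoly (4 * k) ≡[mod5] ((X +P constP (- (+ 2))) ^P (4 * k)))
    × (charPoly (4 * k + 1) ≡[mod5] (-P ((X +P constP (- (+ 1))) ^P (4 * k + 1))))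
    × (charPoly (4 * k + 2) ≡[mod5] ((X +P constP (+ 2)) ^P (4 * k + 2)))
    × (charPoly (4 * k + 3) ≡[mod5] (-P ((X +P constP (+ 1)) ^P (4 * k + 3))))
mainTheorem3 k = case₀ k , ≈ₚ⇒≡[mod5] case₁ , ≈ₚ⇒≡[mod5] case₂ , ≈ₚ⇒≡[mod5] case₃
  where
  case₀ : ∀ k → 1 ≤ 4 * k → charPoly (4 * k) ≡[mod5] ((X +P constP (- (+ 2))) ^P (4 * k))
  case₀ (suc k) _ = ≡.subst (λ n → charPoly n ≡[mod5] ((X +P constP (- (+ 2))) ^P n)) (4*k+4≡4*[1+k] k)
    (≈ₚ⇒≡[mod5] (≈ₚ-trans (charPoly-4k+r k 3 (- (+ 2)) (≡ₘ-intro (divides (+ 5) ≡.refl)))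
                          (≈ₚ-trans (-‿involutive _) (-‿involutive _))))
    where
    4*k+4≡4*[1+k] : ∀ k → 4 * k + 4 ≡ 4 * suc k
    4*k+4≡4*[1+k] = solve-∀ℕ
  case₁ = charPoly-4k+r k 0 (- (+ 1)) ≡ₘ-refl
  case₂ = ≈ₚ-trans (charPoly-4k+r k 1 (+ 2) (≡ₘ-intro (divides (+ 1) ≡.refl))) (-‿involutive _)
  case₃ = ≈ₚ-trans (charPoly-4k+r k 2 (+ 1) (≡ₘ-intro (divides (+ 2) ≡.refl))) (-P-cong (-‿involutive _))
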